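{- Let $f(x)\in\mathbb{Z}[x]$ be a monic polynomial and $p$ a prime with $p^2\mid f(0)$. Then for every integer $\ell>1$ such that $f(x^\ell)$ is irreducible over $\mathbb{Q}$, $p$ divides the index of $f(x^\ell)$.
   Context: For a monic irreducible polynomial $g(x)\in\mathbb{Z}[x]$ with a root $\theta$ and $K=\mathbb{Q}(\theta)$ with ring of integers $\mathbb{Z}_K$, the index of $g$ is $[\mathbb{Z}_K:\mathbb{Z}[\theta]]$. -}

module Defs where

open import Data.Nat as ℕ using (ℕ; zero; suc)
open import Data.Integer as ℤ using (ℤ; +_)
open import Data.Rational using (ℚ; 0ℚ; _/_) renaming (_+_ to _+ℚ_; _*_ to _*ℚ_; -_ to -ℚ_)
open import Data.List using (List; []; _∷_; _++_; map; replicate)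
open import Data.List.Relation.Unary.All using (All)
open import Data.Fin using (Fin)
open import Data.Product using (Σ; ∃; _×_)
open import Data.Sum using (_⊎_)
open import Relation.Binary.PropositionalEquality using (_≡_)
open import Relation.Nullary using (¬_)

-- Polynomials are coefficient lists, lowest degree first.
-- Two lists represent the same polynomial iff they agree up to trailing zeros.

addP : List ℚ → List ℚ → List ℚ
addP [] ys = ys
addP (x ∷ xs) [] = x ∷ xs
addP (x ∷ xs) (y ∷ ys) = (x +ℚ y) ∷ addP xs ys

negP : List ℚ → List ℚ
negP = map -ℚ_

subP : List ℚ → List ℚ → List ℚ
subP a b = addP a (negP b)

scaleP : ℚ → List ℚ → List ℚ
scaleP c = map (c *ℚ_)

mulP : List ℚ → List ℚ → List ℚ
mulP [] ys = []
mulP (x ∷ xs) ys = addP (scaleP x ys) (0ℚ ∷ mulP xs ys)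

IsZeroP : List ℚ → Set
IsZeroP = All (_≡ 0ℚ)

_≈P_ : List ℚ → List ℚ → Set
a ≈P b = IsZeroP (subP a b)

DividesP : List ℚ → List ℚ → Set
DividesP g a = ∃ λ q → mulP q g ≈P a

toℚP : List ℤ → List ℚ
toℚP = map (λ z → z / 1)

Monic : List ℤ → Set
Monic f = ∃ λ cs → f ≡ cs ++ (+ 1 ∷ [])

coeff0 : List ℤ → ℤ
coeff0 [] = + 0
coeff0 (c ∷ _) = c

expand : ℕ → List ℤ → List ℤ
expand ℓ [] = []
expand ℓ (c ∷ []) = c ∷ []
expand ℓ (c ∷ d ∷ cs) = c ∷ (replicate (ℓ ℕ.∸ 1) (+ 0) ++ expand ℓ (d ∷ cs))

IsConstP : List ℚ → Set
IsConstP a = ∃ λ c → a ≈P (c ∷ [])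

IrreducibleQ : List ℚ → Set
IrreducibleQ g = ¬ IsConstP g × (∀ a b → mulP a b ≈P g → IsConstP a ⊎ IsConstP b)

-- K = ℚ[x]/(g); an element is represented by a polynomial α(x), standing for α(θ),
-- θ the class of x.  Evaluate P ∈ ℤ[y] at α (in ℚ[x], to be compared modulo g).
evalAt : List ℤ → List ℚ → List ℚ
evalAt [] α = []
evalAt (c ∷ cs) α = addP (toℚP (c ∷ [])) (mulP α (evalAt cs α))

InZK : List ℚ → List ℚ → Set
InZK g α = ∃ λ P → Monic P × DividesP g (evalAt P α)

InZθ : List ℚ → List ℚ → Set
InZθ g α = ∃ λ h → DividesP g (subP α (toℚP h))

IsIndex : List ℚ → ℕ → Set
IsIndex g m =
  Σ (Fin m → List ℚ) λ reps →
    (∀ i → InZK g (reps i)) ×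
    (∀ α → InZK g α → ∃ λ i → InZθ g (subP α (reps i))) ×
    (∀ i j → InZθ g (subP (reps i) (reps j)) → i ≡ j)

-- Write g(x) = f(x^ℓ) = c₀ + x·G(x) with c₀ = p²c.  As ℓ > 1, g has no linear term, so G(0) = 0
-- and the element η = G(θ)/p satisfies θη = −pc, hence (θη)² = c₀c.  Multiplying g(θ) = 0 by ηⁿ
-- and dividing by c₀ exhibits η as a root of a monic integer polynomial, so η ∈ ℤ_K.  Moreover
-- pη = G(θ) ∈ ℤ[θ], while kη ∈ ℤ[θ] forces p ∣ k because G is monic of degree below deg g.  So η
-- has order p in ℤ_K/ℤ[θ]: translating coset representatives by η permutes the m cosets in orbits
-- of size p, whence p ∣ m.  That α + η is integral for integral α is the determinant trick, run on
-- the monomials αⁱηʲ.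

module Submission where

open import Defs

open import Algebra.Bundles using (CommutativeRing)
open import Algebra.Morphism.Structures using (module RingMorphisms)
open RingMorphisms using (IsRingHomomorphism)
open import Relation.Nullary using (yes; no)
open import Relation.Binary.PropositionalEquality as ≡ using (_≡_; _≢_)
open import Level using (0ℓ; _⊔_)
open import Data.Nat as ℕ using (ℕ; zero; suc; _≤_)
import Data.Nat.Properties as ℕ
open import Data.Integer as ℤ using (ℤ; +_)
open import Data.Rational using (ℚ; 0ℚ; 1ℚ)
open import Data.List using (List; []; _∷_; _++_; length; lookup)
open import Data.Fin as Fin using (Fin; zero; suc; toℕ; _↑ˡ_; _↑ʳ_; combine; remQuot)
import Data.Fin.Properties as Fin
open import Data.Bool using (if_then_else_)
open import Data.Product using (∃; _×_; _,_; proj₁; proj₂)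
open import Data.Nat.GeneralisedArithmetic using (fold; fold-+)
open import Data.Nat.Divisibility using (_∣_)

module IntegerPolynomial where

  open import Data.Nat using (z≤n; s≤s; _+_)
  open import Data.List using (map)
  open import Data.Integer.Properties using (+-comm; *-identityˡ)
  open import Data.List.Properties using (length-map; length-++)
  open import Relation.Binary.PropositionalEquality

  infixl 6 _+ₚ_
  infixl 7 _*ₚ_ _·ₚ_
  infix 8 -ₚ_

  _+ₚ_ : List ℤ → List ℤ → List ℤ
  [] +ₚ ys = ys
  (x ∷ xs) +ₚ [] = x ∷ xs
  (x ∷ xs) +ₚ (y ∷ ys) = (x ℤ.+ y) ∷ (xs +ₚ ys)

  _·ₚ_ : ℤ → List ℤ → List ℤ
  c ·ₚ xs = map (c ℤ.*_) xs

  -ₚ_ : List ℤ → List ℤ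
  -ₚ_ = map (λ x → ℤ.- x)

  _*ₚ_ : List ℤ → List ℤ → List ℤ
  [] *ₚ ys = []
  (x ∷ xs) *ₚ [] = []
  (x ∷ xs) *ₚ (y ∷ ys) = (x ℤ.* y) ∷ (x ·ₚ ys +ₚ xs *ₚ (y ∷ ys))

  ∑ₚ : ∀ {n} → (Fin n → List ℤ) → List ℤ
  ∑ₚ {zero} f = []
  ∑ₚ {suc n} f = f zero +ₚ ∑ₚ (λ i → f (suc i))

  monic : List ℤ → List ℤ
  monic cs = cs ++ (+ 1 ∷ [])

  -- reversal u a bs lists the coefficients of yⁿ·P(u/y), where P = a ∷ bs has degree n.
  reversal : ℤ → ℤ → List ℤ → List ℤ
  reversal u a [] = a ∷ []
  reversal u a (b ∷ bs) = u ·ₚ reversal u b bs ++ (a ∷ [])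

  length-+ₚ-≤ : ∀ {d} xs ys → length xs ≤ d → length ys ≤ d → length (xs +ₚ ys) ≤ d
  length-+ₚ-≤ [] ys _ ys≤ = ys≤
  length-+ₚ-≤ (x ∷ xs) [] xs≤ _ = xs≤
  length-+ₚ-≤ (x ∷ xs) (y ∷ ys) (s≤s xs≤) (s≤s ys≤) = s≤s (length-+ₚ-≤ xs ys xs≤ ys≤)

  length-+ₚ-≡ : ∀ xs ys → length ys ≤ length xs → length (xs +ₚ ys) ≡ length xs
  length-+ₚ-≡ [] [] _ = refl
  length-+ₚ-≡ (x ∷ xs) [] _ = refl
  length-+ₚ-≡ (x ∷ xs) (y ∷ ys) (s≤s ys≤) = cong suc (length-+ₚ-≡ xs ys ys≤)

  length-·ₚ : ∀ c xs → length (c ·ₚ xs) ≡ length xs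
  length-·ₚ c = length-map (c ℤ.*_)

  length-·ₚ-≤ : ∀ {d} c xs → length xs ≤ d → length (c ·ₚ xs) ≤ d
  length-·ₚ-≤ c xs = subst (_≤ _) (sym (length-·ₚ c xs))

  length--ₚ : ∀ xs → length (-ₚ xs) ≡ length xs
  length--ₚ = length-map (λ x → ℤ.- x)

  length-*ₚ-≤ : ∀ {d e} xs ys → length xs ≤ d → length ys ≤ suc e → length (xs *ₚ ys) ≤ d + e
  length-*ₚ-≤ [] ys _ _ = z≤n
  length-*ₚ-≤ (x ∷ xs) [] _ _ = z≤n
  length-*ₚ-≤ {suc d} {e} (x ∷ xs) (y ∷ ys) (s≤s xs≤) (s≤s ys≤) = s≤s (length-+ₚ-≤ (x ·ₚ ys) (xs *ₚ (y ∷ ys))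
    (length-·ₚ-≤ x ys (ℕ.≤-trans ys≤ (ℕ.m≤n+m e d))) (length-*ₚ-≤ xs (y ∷ ys) xs≤ (s≤s ys≤)))

  length-∑ₚ-≤ : ∀ {n d} (f : Fin n → List ℤ) → (∀ i → length (f i) ≤ d) → length (∑ₚ f) ≤ d
  length-∑ₚ-≤ {zero} f _ = z≤n
  length-∑ₚ-≤ {suc n} f f≤ = length-+ₚ-≤ (f zero) (∑ₚ (λ i → f (suc i))) (f≤ zero) (length-∑ₚ-≤ (λ i → f (suc i)) (λ i → f≤ (suc i)))

  length-reversal : ∀ u a bs → length (reversal u a bs) ≡ suc (length bs)
  length-reversal u a [] = refl
  length-reversal u a (b ∷ bs) = trans (length-++ (u ·ₚ reversal u b bs))
    (trans (ℕ.+-comm _ 1) (cong suc (trans (length-·ₚ u (reversal u b bs)) (length-reversal u b bs))))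

  length-monic : ∀ cs → length (monic cs) ≡ suc (length cs)
  length-monic cs = trans (length-++ cs) (ℕ.+-comm (length cs) 1)

  +ₚ-comm : ∀ xs ys → xs +ₚ ys ≡ ys +ₚ xs
  +ₚ-comm [] [] = refl
  +ₚ-comm [] (y ∷ ys) = refl
  +ₚ-comm (x ∷ xs) [] = refl
  +ₚ-comm (x ∷ xs) (y ∷ ys) = cong₂ _∷_ (+-comm x y) (+ₚ-comm xs ys)

  monic-+ₚ : ∀ cs ys → length ys ≤ length cs → monic cs +ₚ ys ≡ monic (cs +ₚ ys)
  monic-+ₚ [] [] _ = refl
  monic-+ₚ (c ∷ cs) [] _ = refl
  monic-+ₚ (c ∷ cs) (y ∷ ys) (s≤s ys≤) = cong ((c ℤ.+ y) ∷_) (monic-+ₚ cs ys ys≤)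

  monic-uncons : ∀ cs → ∃ λ c → ∃ λ cs′ → monic cs ≡ c ∷ cs′ × length cs′ ≡ length cs
  monic-uncons [] = + 1 , [] , refl , refl
  monic-uncons (c ∷ cs) = c , monic cs , refl , length-monic cs

  monic-*ₚ : ∀ cs ds → ∃ λ es → monic cs *ₚ monic ds ≡ monic es × length es ≡ length cs + length ds
  monic-*ₚ [] ds = ds , 1*ₚ (monic ds) , refl
    where
    1·ₚ : ∀ xs → + 1 ·ₚ xs ≡ xs
    1·ₚ [] = refl
    1·ₚ (x ∷ xs) = cong₂ _∷_ (*-identityˡ x) (1·ₚ xs)
    1*ₚ : ∀ xs → (+ 1 ∷ []) *ₚ xs ≡ xs
    1*ₚ [] = refl
    1*ₚ (x ∷ xs) = cong₂ _∷_ (*-identityˡ x) (trans (+ₚ-comm (+ 1 ·ₚ xs) []) (1·ₚ xs))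
  monic-*ₚ (c ∷ cs) ds with monic-uncons ds | monic-*ₚ cs ds
  ... | d , ds′ , ds≡ , ds′-length | es , es≡ , es-length =
    c ℤ.* d ∷ (es +ₚ c ·ₚ ds′) , product , cong suc (trans (length-+ₚ-≡ es (c ·ₚ ds′) short) es-length)
    where
    short : length (c ·ₚ ds′) ≤ length es
    short = subst₂ _≤_ (sym (trans (length-·ₚ c ds′) ds′-length)) (sym es-length) (ℕ.m≤n+m (length ds) (length cs))
    product : (c ∷ monic cs) *ₚ monic ds ≡ monic (c ℤ.* d ∷ (es +ₚ c ·ₚ ds′))
    product = begin
      (c ∷ monic cs) *ₚ monic ds             ≡⟨ cong ((c ∷ monic cs) *ₚ_) ds≡ ⟩
      c ℤ.* d ∷ (c ·ₚ ds′ +ₚ monic cs *ₚ (d ∷ ds′)) ≡⟨ cong (λ t → c ℤ.* d ∷ (c ·ₚ ds′ +ₚ monic cs *ₚ t)) (sym ds≡) ⟩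
      c ℤ.* d ∷ (c ·ₚ ds′ +ₚ monic cs *ₚ monic ds) ≡⟨ cong (λ t → c ℤ.* d ∷ (c ·ₚ ds′ +ₚ t)) es≡ ⟩
      c ℤ.* d ∷ (c ·ₚ ds′ +ₚ monic es)       ≡⟨ cong (c ℤ.* d ∷_) (trans (+ₚ-comm (c ·ₚ ds′) (monic es)) (monic-+ₚ es (c ·ₚ ds′) short)) ⟩
      monic (c ℤ.* d ∷ (es +ₚ c ·ₚ ds′))     ∎
      where open ≡-Reasoning

module IntegerRingSolver {ℓ₁ ℓ₂} (R : CommutativeRing ℓ₁ ℓ₂) (ι : ℤ → CommutativeRing.Carrier R)
  (ι-isHom : IsRingHomomorphism ℤ.+-*-rawRing (CommutativeRing.rawRing R) ι) where

  open CommutativeRing R using (refl)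
  open IsRingHomomorphism ι-isHom
  open import Relation.Binary.Definitions using (WeaklyDecidable)
  open import Data.Maybe using (just; nothing)
  open import Algebra.Solver.Ring.AlmostCommutativeRing
    using (fromCommutativeRing; _-Raw-AlmostCommutative⟶_; Induced-equivalence)

  ι-morphism : ℤ.+-*-rawRing -Raw-AlmostCommutative⟶ fromCommutativeRing R
  ι-morphism = record
    { ⟦_⟧ = ι ; +-homo = +-homo ; *-homo = *-homo ; -‿homo = -‿homo ; 0-homo = 0#-homo ; 1-homo = 1#-homo }

  ι-equal? : WeaklyDecidable (Induced-equivalence ι-morphism)
  ι-equal? a b with a ℤ.≟ b
  ... | yes ≡.refl = just refl
  ... | no _ = nothing

  open import Algebra.Solver.Ring ℤ.+-*-rawRing (fromCommutativeRing R) ι-morphism ι-equal? public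
    using (solve; _:=_; _:+_; _:*_; :-_; _:-_; con)

module Evaluation {ℓ₁ ℓ₂} (R : CommutativeRing ℓ₁ ℓ₂) (ι : ℤ → CommutativeRing.Carrier R)
  (ι-isHom : IsRingHomomorphism ℤ.+-*-rawRing (CommutativeRing.rawRing R) ι) where

  open CommutativeRing R hiding (zero)
  open IsRingHomomorphism ι-isHom using (+-homo; *-homo; -‿homo; 1#-homo)
  open IntegerRingSolver R ι ι-isHom
  open import Relation.Binary.Reasoning.Setoid setoid
  open import Algebra.Properties.Semiring.Sum semiring
  open import Algebra.Properties.Semiring.Exp semiring using (_^_)
  open import Algebra.Properties.CommutativeSemigroup *-commutativeSemigroup using (x∙yz≈y∙xz)
  open import Algebra.Properties.Ring ring using (-1*x≈-x; -0#≈0#)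
  open IntegerPolynomial

  eval : List ℤ → Carrier → Carrier
  eval [] x = 0#
  eval (a ∷ as) x = ι a + x * eval as x

  Integral : Carrier → Set ℓ₂
  Integral x = ∃ λ cs → eval (monic cs) x ≈ 0#

  eval-singleton : ∀ a x → eval (a ∷ []) x ≈ ι a
  eval-singleton a x = trans (+-congˡ (zeroʳ x)) (+-identityʳ (ι a))

  eval-+ₚ : ∀ as bs x → eval (as +ₚ bs) x ≈ eval as x + eval bs x
  eval-+ₚ [] bs x = sym (+-identityˡ _)
  eval-+ₚ (a ∷ as) [] x = sym (+-identityʳ _)
  eval-+ₚ (a ∷ as) (b ∷ bs) x = begin
    ι (a ℤ.+ b) + x * eval (as +ₚ bs) x            ≈⟨ +-cong (+-homo a b) (*-congˡ (eval-+ₚ as bs x)) ⟩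
    (ι a + ι b) + x * (eval as x + eval bs x)
      ≈⟨ solve 5 (λ a b x u v → (a :+ b) :+ x :* (u :+ v) := (a :+ x :* u) :+ (b :+ x :* v)) refl (ι a) (ι b) x (eval as x) (eval bs x) ⟩
    (ι a + x * eval as x) + (ι b + x * eval bs x)  ∎

  eval-·ₚ : ∀ k as x → eval (k ·ₚ as) x ≈ ι k * eval as x
  eval-·ₚ k [] x = sym (zeroʳ (ι k))
  eval-·ₚ k (a ∷ as) x = begin
    ι (k ℤ.* a) + x * eval (k ·ₚ as) x   ≈⟨ +-cong (*-homo k a) (*-congˡ (eval-·ₚ k as x)) ⟩
    ι k * ι a + x * (ι k * eval as x)    ≈⟨ solve 4 (λ k a x u → k :* a :+ x :* (k :* u) := k :* (a :+ x :* u)) refl (ι k) (ι a) x (eval as x) ⟩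
    ι k * (ι a + x * eval as x)          ∎

  eval--ₚ : ∀ as x → eval (-ₚ as) x ≈ - eval as x
  eval--ₚ [] x = sym -0#≈0#
  eval--ₚ (a ∷ as) x = begin
    ι (ℤ.- a) + x * eval (-ₚ as) x   ≈⟨ +-cong (-‿homo a) (*-congˡ (eval--ₚ as x)) ⟩
    - ι a + x * - eval as x          ≈⟨ solve 3 (λ a x u → :- a :+ x :* :- u := :- (a :+ x :* u)) refl (ι a) x (eval as x) ⟩
    - (ι a + x * eval as x)          ∎

  eval-*ₚ : ∀ as bs x → eval (as *ₚ bs) x ≈ eval as x * eval bs x
  eval-*ₚ [] bs x = sym (zeroˡ _)
  eval-*ₚ (a ∷ as) [] x = sym (zeroʳ _)
  eval-*ₚ (a ∷ as) (b ∷ bs) x = begin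
    ι (a ℤ.* b) + x * eval (a ·ₚ bs +ₚ as *ₚ (b ∷ bs)) x
      ≈⟨ +-cong (*-homo a b) (*-congˡ (trans (eval-+ₚ (a ·ₚ bs) (as *ₚ (b ∷ bs)) x) (+-cong (eval-·ₚ a bs x) (eval-*ₚ as (b ∷ bs) x)))) ⟩
    ι a * ι b + x * (ι a * eval bs x + eval as x * (ι b + x * eval bs x))
      ≈⟨ solve 5 (λ a b x u v → a :* b :+ x :* (a :* v :+ u :* (b :+ x :* v)) := (a :+ x :* u) :* (b :+ x :* v))
        refl (ι a) (ι b) x (eval as x) (eval bs x) ⟩
    (ι a + x * eval as x) * (ι b + x * eval bs x) ∎

  eval-++ : ∀ as bs x → eval (as ++ bs) x ≈ eval as x + x ^ length as * eval bs x
  eval-++ [] bs x = trans (sym (*-identityˡ _)) (sym (+-identityˡ _))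
  eval-++ (a ∷ as) bs x = begin
    ι a + x * eval (as ++ bs) x                            ≈⟨ +-congˡ (*-congˡ (eval-++ as bs x)) ⟩
    ι a + x * (eval as x + x ^ length as * eval bs x)
      ≈⟨ solve 5 (λ a x u p v → a :+ x :* (u :+ p :* v) := (a :+ x :* u) :+ (x :* p) :* v) refl (ι a) x (eval as x) (x ^ length as) (eval bs x) ⟩
    (ι a + x * eval as x) + x * x ^ length as * eval bs x  ∎

  eval-∑ₚ : ∀ {n} (f : Fin n → List ℤ) x → eval (∑ₚ f) x ≈ ∑[ i < n ] (eval (f i) x)
  eval-∑ₚ {zero} f x = refl
  eval-∑ₚ {suc n} f x = trans (eval-+ₚ (f zero) (∑ₚ (λ i → f (suc i))) x) (+-congˡ (eval-∑ₚ (λ i → f (suc i)) x))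

  eval-·ₚ-++ : ∀ k as bs x → eval (k ·ₚ as ++ bs) x ≈ ι k * eval as x + x ^ length as * eval bs x
  eval-·ₚ-++ k as bs x = trans (eval-++ (k ·ₚ as) bs x)
    (+-cong (eval-·ₚ k as x) (*-congʳ (reflexive (≡.cong (x ^_) (length-·ₚ k as)))))

  eval-reversal : ∀ {u x y} → x * y ≈ ι u → ∀ a bs → y ^ length bs * eval (a ∷ bs) x ≈ eval (reversal u a bs) y
  eval-reversal {u} {x} {y} xy≈u a [] = trans (*-identityˡ _) (trans (eval-singleton a x) (sym (eval-singleton a y)))
  eval-reversal {u} {x} {y} xy≈u a (b ∷ bs) = begin
    y * y ^ length bs * (ι a + x * eval (b ∷ bs) x)
      ≈⟨ solve 5 (λ y q a x e → y :* q :* (a :+ x :* e) := (x :* y) :* (q :* e) :+ y :* q :* a) refl y (y ^ length bs) (ι a) x (eval (b ∷ bs) x) ⟩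
    (x * y) * (y ^ length bs * eval (b ∷ bs) x) + y * y ^ length bs * ι a
      ≈⟨ +-cong (*-cong xy≈u (eval-reversal xy≈u b bs)) (*-congʳ (reflexive (≡.cong (y ^_) (≡.sym length-scaled)))) ⟩
    ι u * eval (reversal u b bs) y + y ^ length (u ·ₚ reversal u b bs) * ι a
      ≈⟨ +-cong (sym (eval-·ₚ u (reversal u b bs) y)) (*-congˡ (sym (eval-singleton a y))) ⟩
    eval (u ·ₚ reversal u b bs) y + y ^ length (u ·ₚ reversal u b bs) * eval (a ∷ []) y
      ≈⟨ eval-++ (u ·ₚ reversal u b bs) (a ∷ []) y ⟨
    eval (u ·ₚ reversal u b bs ++ (a ∷ [])) y ∎
    where
    length-scaled : length (u ·ₚ reversal u b bs) ≡ suc (length bs)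
    length-scaled = ≡.trans (length-·ₚ u (reversal u b bs)) (length-reversal u b bs)

  eval-as-sum : ∀ ps x → eval ps x ≈ ∑[ i < length ps ] (ι (lookup ps i) * x ^ toℕ i)
  eval-as-sum [] x = refl
  eval-as-sum (p ∷ ps) x = begin
    ι p + x * eval ps x                                                ≈⟨ +-cong (sym (*-identityʳ (ι p))) (*-congˡ (eval-as-sum ps x)) ⟩
    ι p * 1# + x * ∑[ i < length ps ] (ι (lookup ps i) * x ^ toℕ i)
      ≈⟨ +-congˡ (trans (*-distribˡ-sum {length ps} x _) (sum-cong-≋ {length ps} (λ i → x∙yz≈y∙xz x _ _))) ⟩
    ι p * 1# + ∑[ i < length ps ] (ι (lookup ps i) * (x * x ^ toℕ i))  ∎

  top-power : ∀ ps x → eval (monic ps) x ≈ 0# → x ^ length ps ≈ ∑[ i < length ps ] (ι (ℤ.- lookup ps i) * x ^ toℕ i)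
  top-power ps x root = begin
    x ^ length ps                                                      ≈⟨ solve 2 (λ p e → p := e :+ p :- e) refl (x ^ length ps) (eval ps x) ⟩
    eval ps x + x ^ length ps - eval ps x
      ≈⟨ +-congʳ (+-congˡ (sym (trans (*-congˡ (eval-singleton (+ 1) x)) (trans (*-congˡ 1#-homo) (*-identityʳ _))))) ⟩
    eval ps x + x ^ length ps * eval (+ 1 ∷ []) x - eval ps x          ≈⟨ +-congʳ (trans (sym (eval-++ ps (+ 1 ∷ []) x)) root) ⟩
    0# - eval ps x                                                     ≈⟨ trans (+-identityˡ _) (-‿cong (eval-as-sum ps x)) ⟩
    - ∑[ i < length ps ] (ι (lookup ps i) * x ^ toℕ i)                 ≈⟨ trans (sym (-1*x≈-x _)) (*-distribˡ-sum {length ps} (- 1#) _) ⟩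
    ∑[ i < length ps ] (- 1# * (ι (lookup ps i) * x ^ toℕ i))
      ≈⟨ sum-cong-≋ {length ps} (λ i → trans (sym (*-assoc _ _ _)) (*-congʳ (trans (-1*x≈-x _) (sym (-‿homo _))))) ⟩
    ∑[ i < length ps ] (ι (ℤ.- lookup ps i) * x ^ toℕ i)               ∎

module IntegralClosure {ℓ₁ ℓ₂} (R : CommutativeRing ℓ₁ ℓ₂) (ι : ℤ → CommutativeRing.Carrier R)
  (ι-isHom : IsRingHomomorphism ℤ.+-*-rawRing (CommutativeRing.rawRing R) ι) where

  open CommutativeRing R hiding (zero)
  open IsRingHomomorphism ι-isHom using (+-homo; *-homo; 0#-homo; 1#-homo) renaming (⟦⟧-cong to ι-cong)
  open IntegerRingSolver R ι ι-isHom
  open import Relation.Binary.Reasoning.Setoid setoid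
  open import Algebra.Properties.Semiring.Sum semiring
  open import Algebra.Properties.Semiring.Exp semiring using (_^_)
  open import Algebra.Properties.CommutativeSemigroup *-commutativeSemigroup using (x∙yz≈y∙xz)
  open IntegerPolynomial
  open Evaluation R ι ι-isHom

  kronecker : ℕ → ℕ → ℤ
  kronecker m n = if m ℕ.≡ᵇ n then + 1 else + 0

  ∑-zero : ∀ {n} (f : Fin n → Carrier) → (∀ i → f i ≈ 0#) → ∑[ i < n ] f i ≈ 0#
  ∑-zero {n} f f≈0 = trans (sum-cong-≋ {n} f≈0) (sum-replicate-zero n)

  ∑-kronecker : ∀ {n} (j₀ : Fin n) (f : Fin n → Carrier) → ∑[ j < n ] (ι (kronecker (toℕ j₀) (toℕ j)) * f j) ≈ f j₀
  ∑-kronecker zero f = begin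
    ι (+ 1) * f zero + ∑[ j < _ ] (ι (+ 0) * f (suc j))
      ≈⟨ +-cong (trans (*-congʳ 1#-homo) (*-identityˡ _)) (∑-zero (λ j → ι (+ 0) * f (suc j)) (λ j → trans (*-congʳ 0#-homo) (zeroˡ _))) ⟩
    f zero + 0#                                          ≈⟨ +-identityʳ _ ⟩
    f zero                                               ∎
  ∑-kronecker (suc j₀) f = begin
    ι (+ 0) * f zero + ∑[ j < _ ] (ι (kronecker (toℕ j₀) (toℕ j)) * f (suc j))
      ≈⟨ +-cong (trans (*-congʳ 0#-homo) (zeroˡ _)) (∑-kronecker j₀ (λ j → f (suc j))) ⟩
    0# + f (suc j₀)                                                             ≈⟨ +-identityˡ _ ⟩
    f (suc j₀)                                                                  ∎

  ∑-++ : ∀ m {n} (f : Fin (m ℕ.+ n) → Carrier) → ∑[ k < m ℕ.+ n ] f k ≈ ∑[ i < m ] f (i ↑ˡ n) + ∑[ j < n ] f (m ↑ʳ j)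
  ∑-++ zero f = sym (+-identityˡ _)
  ∑-++ (suc m) f = trans (+-congˡ (∑-++ m (λ k → f (suc k)))) (sym (+-assoc _ _ _))

  ∑-combine : ∀ m n (f : Fin (m ℕ.* n) → Carrier) → ∑[ k < m ℕ.* n ] f k ≈ ∑[ i < m ] ∑[ j < n ] f (combine i j)
  ∑-combine zero n f = refl
  ∑-combine (suc m) n f = trans (∑-++ n f) (+-congˡ (∑-combine m n (λ k → f (n ↑ʳ k))))

  -- One step of Gaussian elimination on s·v = T·v + u, where P and α play the roles of the
  -- determinant and adjugate of the minor; X = (s − a)·P − b·α·c is the Schur complement.
  module SchurStep {m : ℕ} (s a v₀ u₀ P : Carrier) (b c v u : Fin m → Carrier) (α : Fin m → Fin m → Carrier)
    (first-row : s * v₀ ≈ (a * v₀ + ∑[ j < m ] (b j * v j)) + u₀)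
    (minor : ∀ i → P * v i ≈ ∑[ k < m ] (α i k * (c k * v₀ + u k))) where

    β : Fin m → Carrier
    β k = ∑[ j < m ] (b j * α j k)

    γ : Fin m → Carrier
    γ i = ∑[ k < m ] (c k * α i k)

    B : Carrier
    B = ∑[ j < m ] ∑[ k < m ] (b j * c k * α j k)

    X : Carrier
    X = s * P - (a * P + B)

    expand-minors : ∑[ j < m ] (b j * (P * v j)) ≈ B * v₀ + ∑[ k < m ] (β k * u k)
    expand-minors = begin
      ∑[ j < m ] (b j * (P * v j))
        ≈⟨ sum-cong-≋ {m} (λ j → *-congˡ (minor j)) ⟩
      ∑[ j < m ] (b j * ∑[ k < m ] (α j k * (c k * v₀ + u k)))
        ≈⟨ sum-cong-≋ {m} (λ j → trans (*-distribˡ-sum {m} (b j) _) (sum-cong-≋ {m} (λ k →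
             solve 5 (λ b c α v w → b :* (α :* (c :* v :+ w)) := b :* c :* α :* v :+ b :* α :* w) refl (b j) (c k) (α j k) v₀ (u k)))) ⟩
      ∑[ j < m ] ∑[ k < m ] (b j * c k * α j k * v₀ + b j * α j k * u k)
        ≈⟨ trans (sum-cong-≋ {m} (λ j → ∑-distrib-+ {m} _ _)) (∑-distrib-+ {m} _ _) ⟩
      ∑[ j < m ] ∑[ k < m ] (b j * c k * α j k * v₀) + ∑[ j < m ] ∑[ k < m ] (b j * α j k * u k)
        ≈⟨ +-cong (sym (trans (*-distribʳ-sum {m} v₀ _) (sum-cong-≋ {m} (λ j → *-distribʳ-sum {m} v₀ _)))) (∑-comm {m} {m} _) ⟩
      B * v₀ + ∑[ k < m ] ∑[ j < m ] (b j * α j k * u k)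
        ≈⟨ +-congˡ (sum-cong-≋ {m} (λ k → sym (*-distribʳ-sum {m} (u k) _))) ⟩
      B * v₀ + ∑[ k < m ] (β k * u k) ∎

    pivot : X * v₀ ≈ P * u₀ + ∑[ k < m ] (β k * u k)
    pivot = begin
      X * v₀
        ≈⟨ solve 5 (λ s a P B v → (s :* P :- (a :* P :+ B)) :* v := P :* (s :* v) :- a :* P :* v :- B :* v) refl s a P B v₀ ⟩
      P * (s * v₀) - a * P * v₀ - B * v₀
        ≈⟨ +-congʳ (+-congʳ (*-congˡ first-row)) ⟩
      P * ((a * v₀ + ∑[ j < m ] (b j * v j)) + u₀) - a * P * v₀ - B * v₀
        ≈⟨ solve 6 (λ P a v S w B → P :* ((a :* v :+ S) :+ w) :- a :* P :* v :- B :* v := P :* S :+ P :* w :- B :* v) refl P a v₀ _ u₀ B ⟩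
      P * ∑[ j < m ] (b j * v j) + P * u₀ - B * v₀
        ≈⟨ +-congʳ (+-congʳ (trans (*-distribˡ-sum {m} P _) (sum-cong-≋ {m} (λ j → x∙yz≈y∙xz P (b j) (v j))))) ⟩
      ∑[ j < m ] (b j * (P * v j)) + P * u₀ - B * v₀
        ≈⟨ +-congʳ (+-congʳ expand-minors) ⟩
      B * v₀ + ∑[ k < m ] (β k * u k) + P * u₀ - B * v₀
        ≈⟨ solve 3 (λ B S p → B :+ S :+ p :- B := p :+ S) refl (B * v₀) _ (P * u₀) ⟩
      P * u₀ + ∑[ k < m ] (β k * u k) ∎

    pivot-row : X * P * v₀ ≈ P * P * u₀ + ∑[ k < m ] (β k * P * u k)
    pivot-row = begin
      X * P * v₀                                 ≈⟨ solve 3 (λ X P v → X :* P :* v := P :* (X :* v)) refl X P v₀ ⟩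
      P * (X * v₀)                               ≈⟨ *-congˡ pivot ⟩
      P * (P * u₀ + ∑[ k < m ] (β k * u k))        ≈⟨ trans (distribˡ P _ _) (+-cong (sym (*-assoc P P u₀)) (*-distribˡ-sum {m} P _)) ⟩
      P * P * u₀ + ∑[ k < m ] (P * (β k * u k))
        ≈⟨ +-congˡ (sum-cong-≋ {m} (λ k → solve 3 (λ P b w → P :* (b :* w) := b :* P :* w) refl P (β k) (u k))) ⟩
      P * P * u₀ + ∑[ k < m ] (β k * P * u k)      ∎

    minor-row : ∀ i → X * P * v i ≈ γ i * P * u₀ + ∑[ k < m ] ((α i k * X + γ i * β k) * u k)
    minor-row i = begin
      X * P * v i
        ≈⟨ trans (*-assoc X P (v i)) (*-congˡ (minor i)) ⟩
      X * ∑[ k < m ] (α i k * (c k * v₀ + u k))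
        ≈⟨ trans (*-distribˡ-sum {m} X _) (sum-cong-≋ {m} (λ k →
             solve 5 (λ X α c v w → X :* (α :* (c :* v :+ w)) := c :* α :* (X :* v) :+ α :* X :* w) refl X (α i k) (c k) v₀ (u k))) ⟩
      ∑[ k < m ] (c k * α i k * (X * v₀) + α i k * X * u k)
        ≈⟨ trans (∑-distrib-+ {m} _ _) (+-congʳ (sym (*-distribʳ-sum {m} (X * v₀) _))) ⟩
      γ i * (X * v₀) + ∑[ k < m ] (α i k * X * u k)
        ≈⟨ +-congʳ (*-congˡ pivot) ⟩
      γ i * (P * u₀ + ∑[ k < m ] (β k * u k)) + ∑[ k < m ] (α i k * X * u k)
        ≈⟨ +-congʳ (trans (distribˡ (γ i) _ _) (+-cong (sym (*-assoc (γ i) P u₀)) (*-distribˡ-sum {m} (γ i) _))) ⟩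
      γ i * P * u₀ + ∑[ k < m ] (γ i * (β k * u k)) + ∑[ k < m ] (α i k * X * u k)
        ≈⟨ trans (+-assoc _ _ _) (+-congˡ (trans (+-comm _ _) (sym (∑-distrib-+ {m} _ _)))) ⟩
      γ i * P * u₀ + ∑[ k < m ] (α i k * X * u k + γ i * (β k * u k))
        ≈⟨ +-congˡ (sum-cong-≋ {m} (λ k → solve 5 (λ α X g b w → α :* X :* w :+ g :* (b :* w) := (α :* X :+ g :* b) :* w)
          refl (α i k) X (γ i) (β k) (u k))) ⟩
      γ i * P * u₀ + ∑[ k < m ] ((α i k * X + γ i * β k) * u k) ∎

  -- monic coeffs and adj play the roles of det(s − T) and its adjugate.  Eliminating the first row
  -- avoids determinants, but multiplies by the minor's polynomial, so the degree is 2d + 1, not n.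
  record Adjugate (n : ℕ) (T : Fin n → Fin n → ℤ) : Set (ℓ₁ ⊔ ℓ₂) where
    field
      degree : ℕ
      coeffs : List ℤ
      coeffs-length : length coeffs ≡ degree
      adj : Fin n → Fin n → List ℤ
      adj-length : ∀ i j → length (adj i j) ≤ degree
      identity : ∀ s (v u : Fin n → Carrier) →
        (∀ i → s * v i ≈ ∑[ j < n ] (ι (T i j) * v j) + u i) →
        ∀ i → eval (monic coeffs) s * v i ≈ ∑[ k < n ] (eval (adj i k) s * u k)

  module AdjugateStep {m : ℕ} (T : Fin (suc m) → Fin (suc m) → ℤ)
    (minor : Adjugate m (λ i j → T (suc i) (suc j))) where

    open Adjugate minor renaming (degree to d; coeffs to cs; coeffs-length to cs-length; adj to A′;
                                  adj-length to A′-length; identity to minor-identity)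

    a : ℤ
    a = T zero zero

    b c : Fin m → ℤ
    b j = T zero (suc j)
    c i = T (suc i) zero

    Φ′ : List ℤ
    Φ′ = monic cs

    Bₚ Cₚ : Fin m → List ℤ
    Bₚ k = ∑ₚ (λ j → b j ·ₚ A′ j k)
    Cₚ i = ∑ₚ (λ k → c k ·ₚ A′ i k)

    Dₚ : List ℤ
    Dₚ = ∑ₚ (λ j → ∑ₚ (λ k → (b j ℤ.* c k) ·ₚ A′ j k))

    tailₚ : List ℤ
    tailₚ = -ₚ (a ·ₚ Φ′ +ₚ Dₚ)

    χcs : List ℤ
    χcs = (+ 0 ∷ cs) +ₚ tailₚ

    χ : List ℤ
    χ = monic χcs

    Φ′-length : length Φ′ ≤ suc d
    Φ′-length = ℕ.≤-reflexive (≡.trans (length-monic cs) (≡.cong suc cs-length))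

    Bₚ-length : ∀ k → length (Bₚ k) ≤ d
    Bₚ-length k = length-∑ₚ-≤ _ (λ j → length-·ₚ-≤ (b j) (A′ j k) (A′-length j k))

    Cₚ-length : ∀ i → length (Cₚ i) ≤ d
    Cₚ-length i = length-∑ₚ-≤ _ (λ k → length-·ₚ-≤ (c k) (A′ i k) (A′-length i k))

    tailₚ-length : length tailₚ ≤ length (+ 0 ∷ cs)
    tailₚ-length = ≡.subst₂ _≤_ (≡.sym (length--ₚ (a ·ₚ Φ′ +ₚ Dₚ))) (≡.cong suc (≡.sym cs-length))
      (length-+ₚ-≤ (a ·ₚ Φ′) Dₚ (length-·ₚ-≤ a Φ′ Φ′-length) (ℕ.≤-trans Dₚ-length (ℕ.n≤1+n d)))
      where
      Dₚ-length : length Dₚ ≤ d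
      Dₚ-length = length-∑ₚ-≤ _ (λ j → length-∑ₚ-≤ _ (λ k → length-·ₚ-≤ (b j ℤ.* c k) (A′ j k) (A′-length j k)))

    χ≡ : (+ 0 ∷ Φ′) +ₚ tailₚ ≡ χ
    χ≡ = monic-+ₚ (+ 0 ∷ cs) tailₚ tailₚ-length

    χcs-length : length χcs ≡ suc d
    χcs-length = ≡.trans (length-+ₚ-≡ (+ 0 ∷ cs) tailₚ tailₚ-length) (≡.cong suc cs-length)

    χ-length : length χ ≤ suc (suc d)
    χ-length = ℕ.≤-reflexive (≡.trans (length-monic χcs) (≡.cong suc χcs-length))

    product : ∃ λ es → χ *ₚ Φ′ ≡ monic es × length es ≡ length χcs ℕ.+ length cs
    product = monic-*ₚ χcs cs

    Φcs : List ℤ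
    Φcs = proj₁ product

    Φcs-length : length Φcs ≡ suc d ℕ.+ d
    Φcs-length = ≡.trans (proj₂ (proj₂ product)) (≡.cong₂ ℕ._+_ χcs-length cs-length)

    A : Fin (suc m) → Fin (suc m) → List ℤ
    A zero zero = Φ′ *ₚ Φ′
    A zero (suc k) = Bₚ k *ₚ Φ′
    A (suc i) zero = Cₚ i *ₚ Φ′
    A (suc i) (suc k) = A′ i k *ₚ χ +ₚ Cₚ i *ₚ Bₚ k

    A-length : ∀ i k → length (A i k) ≤ suc d ℕ.+ d
    A-length zero zero = length-*ₚ-≤ Φ′ Φ′ Φ′-length Φ′-length
    A-length zero (suc k) = ℕ.≤-trans (length-*ₚ-≤ (Bₚ k) Φ′ (Bₚ-length k) Φ′-length) (ℕ.n≤1+n _)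
    A-length (suc i) zero = ℕ.≤-trans (length-*ₚ-≤ (Cₚ i) Φ′ (Cₚ-length i) Φ′-length) (ℕ.n≤1+n _)
    A-length (suc i) (suc k) = length-+ₚ-≤ (A′ i k *ₚ χ) (Cₚ i *ₚ Bₚ k)
      (≡.subst (length (A′ i k *ₚ χ) ≤_) (ℕ.+-comm d (suc d)) (length-*ₚ-≤ (A′ i k) χ (A′-length i k) χ-length))
      (ℕ.≤-trans (length-*ₚ-≤ (Cₚ i) (Bₚ k) (Cₚ-length i) (ℕ.≤-trans (Bₚ-length k) (ℕ.n≤1+n d))) (ℕ.n≤1+n _))

    module _ (s : Carrier) (v u : Fin (suc m) → Carrier)
      (rows : ∀ i → s * v i ≈ ∑[ j < suc m ] (ι (T i j) * v j) + u i) where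

      α : Fin m → Fin m → Carrier
      α j k = eval (A′ j k) s

      minor-rows : ∀ i → s * v (suc i) ≈ ∑[ j < m ] (ι (T (suc i) (suc j)) * v (suc j)) + (ι (c i) * v zero + u (suc i))
      minor-rows i = trans (rows (suc i)) (solve 3 (λ x y z → (x :+ y) :+ z := y :+ (x :+ z)) refl _ _ _)

      open SchurStep s (ι a) (v zero) (u zero) (eval Φ′ s) (λ j → ι (b j)) (λ k → ι (c k))
        (λ j → v (suc j)) (λ k → u (suc k)) α (rows zero) (minor-identity s (λ j → v (suc j)) _ minor-rows)

      eval-Bₚ : ∀ k → eval (Bₚ k) s ≈ β k
      eval-Bₚ k = trans (eval-∑ₚ (λ j → b j ·ₚ A′ j k) s) (sum-cong-≋ {m} (λ j → eval-·ₚ (b j) (A′ j k) s))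

      eval-Cₚ : ∀ i → eval (Cₚ i) s ≈ γ i
      eval-Cₚ i = trans (eval-∑ₚ (λ k → c k ·ₚ A′ i k) s) (sum-cong-≋ {m} (λ k → eval-·ₚ (c k) (A′ i k) s))

      eval-Dₚ : eval Dₚ s ≈ B
      eval-Dₚ = trans (eval-∑ₚ (λ j → ∑ₚ (λ k → (b j ℤ.* c k) ·ₚ A′ j k)) s) (sum-cong-≋ {m} λ j →
        trans (eval-∑ₚ (λ k → (b j ℤ.* c k) ·ₚ A′ j k) s) (sum-cong-≋ {m} λ k →
          trans (eval-·ₚ (b j ℤ.* c k) (A′ j k) s) (*-congʳ (*-homo (b j) (c k)))))

      eval-χ : eval χ s ≈ X
      eval-χ = begin
        eval χ s                                              ≡⟨ ≡.cong (λ p → eval p s) χ≡ ⟨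
        eval ((+ 0 ∷ Φ′) +ₚ tailₚ) s                          ≈⟨ eval-+ₚ (+ 0 ∷ Φ′) tailₚ s ⟩
        (ι (+ 0) + s * eval Φ′ s) + eval tailₚ s               ≈⟨ +-cong (+-congʳ 0#-homo) (eval--ₚ (a ·ₚ Φ′ +ₚ Dₚ) s) ⟩
        (0# + s * eval Φ′ s) - eval (a ·ₚ Φ′ +ₚ Dₚ) s          ≈⟨ +-cong (+-identityˡ _) (-‿cong (eval-+ₚ (a ·ₚ Φ′) Dₚ s)) ⟩
        s * eval Φ′ s - (eval (a ·ₚ Φ′) s + eval Dₚ s)         ≈⟨ +-congˡ (-‿cong (+-cong (eval-·ₚ a Φ′ s) eval-Dₚ)) ⟩
        X                                                     ∎

      eval-det : eval (monic Φcs) s ≈ X * eval Φ′ s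
      eval-det = begin
        eval (monic Φcs) s   ≡⟨ ≡.cong (λ p → eval p s) (proj₁ (proj₂ product)) ⟨
        eval (χ *ₚ Φ′) s     ≈⟨ trans (eval-*ₚ χ Φ′ s) (*-congʳ eval-χ) ⟩
        X * eval Φ′ s        ∎

      identity : ∀ i → eval (monic Φcs) s * v i ≈ ∑[ k < suc m ] (eval (A i k) s * u k)
      identity zero = begin
        eval (monic Φcs) s * v zero
          ≈⟨ trans (*-congʳ eval-det) pivot-row ⟩
        eval Φ′ s * eval Φ′ s * u zero + ∑[ k < m ] (β k * eval Φ′ s * u (suc k))
          ≈⟨ +-cong (*-congʳ (sym (eval-*ₚ Φ′ Φ′ s))) (sum-cong-≋ {m} (λ k → *-congʳ (sym (trans (eval-*ₚ (Bₚ k) Φ′ s) (*-congʳ (eval-Bₚ k)))))) ⟩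
        ∑[ k < suc m ] (eval (A zero k) s * u k) ∎
      identity (suc i) = begin
        eval (monic Φcs) s * v (suc i)
          ≈⟨ trans (*-congʳ eval-det) (minor-row i) ⟩
        γ i * eval Φ′ s * u zero + ∑[ k < m ] ((α i k * X + γ i * β k) * u (suc k))
          ≈⟨ +-cong (*-congʳ (sym (trans (eval-*ₚ (Cₚ i) Φ′ s) (*-congʳ (eval-Cₚ i)))))
                    (sum-cong-≋ {m} (λ k → *-congʳ (sym eval-entry))) ⟩
        ∑[ k < suc m ] (eval (A (suc i) k) s * u k) ∎
        where
        eval-entry : ∀ {k} → eval (A′ i k *ₚ χ +ₚ Cₚ i *ₚ Bₚ k) s ≈ α i k * X + γ i * β k
        eval-entry {k} = trans (eval-+ₚ (A′ i k *ₚ χ) (Cₚ i *ₚ Bₚ k) s)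
          (+-cong (trans (eval-*ₚ (A′ i k) χ s) (*-congˡ eval-χ)) (trans (eval-*ₚ (Cₚ i) (Bₚ k) s) (*-cong (eval-Cₚ i) (eval-Bₚ k))))

    adjugate-suc : Adjugate (suc m) T
    adjugate-suc = record
      { degree = suc d ℕ.+ d ; coeffs = Φcs ; coeffs-length = Φcs-length
      ; adj = A ; adj-length = A-length ; identity = identity }

  adjugate : ∀ n T → Adjugate n T
  adjugate zero T = record
    { degree = 0 ; coeffs = [] ; coeffs-length = ≡.refl ; adj = λ () ; adj-length = λ () ; identity = λ _ _ _ _ () }
  adjugate (suc m) T = AdjugateStep.adjugate-suc T (adjugate m (λ i j → T (suc i) (suc j)))

  companion : (ps : List ℤ) → Fin (length ps) → Fin (length ps) → ℤ
  companion ps i j with suc (toℕ i) ℕ.≟ length ps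
  ... | yes _ = ℤ.- lookup ps j
  ... | no _ = kronecker (suc (toℕ i)) (toℕ j)

  companion-power : ∀ ps x → eval (monic ps) x ≈ 0# →
    ∀ i → x * x ^ toℕ i ≈ ∑[ j < length ps ] (ι (companion ps i j) * x ^ toℕ j)
  companion-power ps x root i with suc (toℕ i) ℕ.≟ length ps
  ... | yes last = trans (reflexive (≡.cong (x ^_) last)) (top-power ps x root)
  ... | no not-last = sym (trans (sum-cong-≋ {length ps} (λ j → *-congʳ (ι-cong (≡.cong (λ t → kronecker t (toℕ j)) (≡.sym next-index)))))
                                 (trans (∑-kronecker next (λ j → x ^ toℕ j)) (reflexive (≡.cong (x ^_) next-index))))
    where
    next-bound : suc (toℕ i) ℕ.< length ps
    next-bound = ℕ.≤∧≢⇒< (Fin.toℕ<n i) not-last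
    next : Fin (length ps)
    next = Fin.fromℕ< next-bound
    next-index : toℕ next ≡ suc (toℕ i)
    next-index = Fin.toℕ-fromℕ< next-bound

  -- x + y acts on the monomials xⁱyʲ (i < deg x, j < deg y) by an integer matrix.
  module MonomialBasis {x y : Carrier} (ps qs : List ℤ)
    (x-root : eval (monic ps) x ≈ 0#) (y-root : eval (monic qs) y ≈ 0#) where

    d e : ℕ
    d = length ps
    e = length qs

    pair : Fin (d ℕ.* e) → Fin d × Fin e
    pair = remQuot {d} e

    monomial : Fin d × Fin e → Carrier
    monomial (i , j) = x ^ toℕ i * y ^ toℕ j

    sum-matrix : Fin d × Fin e → Fin d × Fin e → ℤ
    sum-matrix (i , j) (i′ , j′) =
      kronecker (toℕ j) (toℕ j′) ℤ.* companion ps i i′ ℤ.+ kronecker (toℕ i) (toℕ i′) ℤ.* companion qs j j′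

    ∑-monomials : ∀ (f : Fin d × Fin e → Carrier) → ∑[ k < d ℕ.* e ] f (pair k) ≈ ∑[ i < d ] ∑[ j < e ] f (i , j)
    ∑-monomials f = trans (∑-combine d e (λ k → f (pair k)))
      (sum-cong-≋ {d} (λ i → sum-cong-≋ {e} (λ j → reflexive (≡.cong f (Fin.remQuot-combine i j)))))

    sum-rows : ∀ i j → (x + y) * monomial (i , j) ≈ ∑[ k < d ℕ.* e ] (ι (sum-matrix (i , j) (pair k)) * monomial (pair k))
    sum-rows i j = sym (begin
      ∑[ k < d ℕ.* e ] (ι (sum-matrix (i , j) (pair k)) * monomial (pair k))
        ≈⟨ ∑-monomials (λ m → ι (sum-matrix (i , j) m) * monomial m) ⟩
      ∑[ i′ < d ] ∑[ j′ < e ] (ι (sum-matrix (i , j) (i′ , j′)) * monomial (i′ , j′))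
        ≈⟨ sum-cong-≋ {d} (λ i′ → sum-cong-≋ {e} (λ j′ → split-entry i′ j′)) ⟩
      ∑[ i′ < d ] ∑[ j′ < e ] (ι (companion ps i i′) * x ^ toℕ i′ * (ι (kronecker (toℕ j) (toℕ j′)) * y ^ toℕ j′)
                              + ι (kronecker (toℕ i) (toℕ i′)) * x ^ toℕ i′ * (ι (companion qs j j′) * y ^ toℕ j′))
        ≈⟨ trans (sum-cong-≋ {d} (λ i′ → ∑-distrib-+ {e} _ _)) (∑-distrib-+ {d} _ _) ⟩
      ∑[ i′ < d ] ∑[ j′ < e ] (ι (companion ps i i′) * x ^ toℕ i′ * (ι (kronecker (toℕ j) (toℕ j′)) * y ^ toℕ j′))
        + ∑[ i′ < d ] ∑[ j′ < e ] (ι (kronecker (toℕ i) (toℕ i′)) * x ^ toℕ i′ * (ι (companion qs j j′) * y ^ toℕ j′))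
        ≈⟨ +-cong x-part (trans (∑-comm {d} {e} _) y-part) ⟩
      x * x ^ toℕ i * y ^ toℕ j + x ^ toℕ i * (y * y ^ toℕ j)
        ≈⟨ solve 4 (λ x y p q → x :* p :* q :+ p :* (y :* q) := (x :+ y) :* (p :* q)) refl x y (x ^ toℕ i) (y ^ toℕ j) ⟩
      (x + y) * monomial (i , j) ∎)
      where
      split-entry : ∀ i′ j′ → ι (sum-matrix (i , j) (i′ , j′)) * monomial (i′ , j′) ≈
        ι (companion ps i i′) * x ^ toℕ i′ * (ι (kronecker (toℕ j) (toℕ j′)) * y ^ toℕ j′)
        + ι (kronecker (toℕ i) (toℕ i′)) * x ^ toℕ i′ * (ι (companion qs j j′) * y ^ toℕ j′)
      split-entry i′ j′ = trans (*-congʳ (trans (+-homo _ _) (+-cong (*-homo _ _) (*-homo _ _))))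
        (solve 6 (λ δ₁ c₁ δ₂ c₂ p q → (δ₁ :* c₁ :+ δ₂ :* c₂) :* (p :* q) := c₁ :* p :* (δ₁ :* q) :+ δ₂ :* p :* (c₂ :* q))
          refl _ _ _ _ (x ^ toℕ i′) (y ^ toℕ j′))
      x-part : ∑[ i′ < d ] ∑[ j′ < e ] (ι (companion ps i i′) * x ^ toℕ i′ * (ι (kronecker (toℕ j) (toℕ j′)) * y ^ toℕ j′))
               ≈ x * x ^ toℕ i * y ^ toℕ j
      x-part = begin
        ∑[ i′ < d ] ∑[ j′ < e ] (ι (companion ps i i′) * x ^ toℕ i′ * (ι (kronecker (toℕ j) (toℕ j′)) * y ^ toℕ j′))
          ≈⟨ sum-cong-≋ {d} (λ i′ → trans (sym (*-distribˡ-sum {e} _ _)) (*-congˡ (∑-kronecker j (λ j′ → y ^ toℕ j′)))) ⟩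
        ∑[ i′ < d ] (ι (companion ps i i′) * x ^ toℕ i′ * y ^ toℕ j)
          ≈⟨ trans (sym (*-distribʳ-sum {d} _ _)) (*-congʳ (sym (companion-power ps x x-root i))) ⟩
        x * x ^ toℕ i * y ^ toℕ j ∎
      y-part : ∑[ j′ < e ] ∑[ i′ < d ] (ι (kronecker (toℕ i) (toℕ i′)) * x ^ toℕ i′ * (ι (companion qs j j′) * y ^ toℕ j′))
               ≈ x ^ toℕ i * (y * y ^ toℕ j)
      y-part = begin
        ∑[ j′ < e ] ∑[ i′ < d ] (ι (kronecker (toℕ i) (toℕ i′)) * x ^ toℕ i′ * (ι (companion qs j j′) * y ^ toℕ j′))
          ≈⟨ sum-cong-≋ {e} (λ j′ → trans (sym (*-distribʳ-sum {d} _ _)) (*-congʳ (∑-kronecker i (λ i′ → x ^ toℕ i′)))) ⟩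
        ∑[ j′ < e ] (x ^ toℕ i * (ι (companion qs j j′) * y ^ toℕ j′))
          ≈⟨ trans (sym (*-distribˡ-sum {e} _ _)) (*-congˡ (sym (companion-power qs y y-root j))) ⟩
        x ^ toℕ i * (y * y ^ toℕ j) ∎

    open Adjugate (adjugate (d ℕ.* e) (λ k l → sum-matrix (pair k) (pair l))) public using (coeffs)
    open Adjugate (adjugate (d ℕ.* e) (λ k l → sum-matrix (pair k) (pair l))) using (identity)

    annihilates-monomials : ∀ k → eval (monic coeffs) (x + y) * monomial (pair k) ≈ 0#
    annihilates-monomials k = trans (identity (x + y) (λ k → monomial (pair k)) (λ _ → 0#) rows k) (∑-zero {d ℕ.* e} _ (λ l → zeroʳ _))
      where
      rows : ∀ k → (x + y) * monomial (pair k) ≈ ∑[ l < d ℕ.* e ] (ι (sum-matrix (pair k) (pair l)) * monomial (pair l)) + 0#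
      rows k = trans (sum-rows (proj₁ (pair k)) (proj₂ (pair k))) (sym (+-identityʳ _))

  integral-+ : ∀ {x y} → Integral x → Integral y → Integral (x + y)
  integral-+ {x} {y} ([] , x-root) _ = [] , trans (eval-singleton (+ 1) (x + y)) (trans (sym (eval-singleton (+ 1) x)) x-root)
  integral-+ {x} {y} (_ ∷ _ , _) ([] , y-root) = [] , trans (eval-singleton (+ 1) (x + y)) (trans (sym (eval-singleton (+ 1) y)) y-root)
  integral-+ {x} {y} (p ∷ ps , x-root) (q ∷ qs , y-root) = coeffs , (begin
    eval (monic coeffs) (x + y)                                     ≈⟨ trans (*-congˡ (*-identityʳ 1#)) (*-identityʳ _) ⟨
    eval (monic coeffs) (x + y) * (1# * 1#)
      ≡⟨ ≡.cong (λ m → eval (monic coeffs) (x + y) * monomial m) (Fin.remQuot-combine {d} {e} zero zero) ⟨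
    eval (monic coeffs) (x + y) * monomial (pair (combine {d} {e} zero zero))  ≈⟨ annihilates-monomials (combine {d} {e} zero zero) ⟩
    0#                                                              ∎)
    where open MonomialBasis (p ∷ ps) (q ∷ qs) x-root y-root

module IntegerToRational where

  open import Data.Integer using (-[1+_])
  open import Data.Integer.Properties using (*-identityʳ)
  open import Data.Rational as ℚ using (ℚ; mkℚ; _/_; ↥_)
  open import Data.Rational.Properties using (normalize-coprime)
  open import Data.Nat.Coprimality as Coprime using (1-coprimeTo)
  open import Relation.Binary.PropositionalEquality

  private
    canonical : ℤ → ℚ
    canonical z = mkℚ z 0 (Coprime.sym (1-coprimeTo ℤ.∣ z ∣))

    /1≡canonical : ∀ z → z / 1 ≡ canonical z
    /1≡canonical (+ n) = normalize-coprime (Coprime.sym (1-coprimeTo n))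
    /1≡canonical -[1+ n ] = cong ℚ.-_ (normalize-coprime (Coprime.sym (1-coprimeTo (suc n))))

    canonical-neg : ∀ z → canonical (ℤ.- z) ≡ ℚ.- canonical z
    canonical-neg (+ zero) = refl
    canonical-neg (+ suc n) = refl
    canonical-neg -[1+ n ] = refl

  /1-+ : ∀ a b → (a ℤ.+ b) / 1 ≡ (a / 1) ℚ.+ (b / 1)
  /1-+ a b = sym (trans (cong₂ ℚ._+_ (/1≡canonical a) (/1≡canonical b))
                        (cong₂ (λ x y → (x ℤ.+ y) / 1) (*-identityʳ a) (*-identityʳ b)))

  /1-* : ∀ a b → (a ℤ.* b) / 1 ≡ (a / 1) ℚ.* (b / 1)
  /1-* a b = sym (cong₂ ℚ._*_ (/1≡canonical a) (/1≡canonical b))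

  /1-neg : ∀ a → (ℤ.- a) / 1 ≡ ℚ.- (a / 1)
  /1-neg a = trans (/1≡canonical (ℤ.- a)) (trans (canonical-neg a) (cong ℚ.-_ (sym (/1≡canonical a))))

  /1-injective : ∀ {a b} → a / 1 ≡ b / 1 → a ≡ b
  /1-injective {a} {b} eq = cong ↥_ (trans (sym (/1≡canonical a)) (trans eq (/1≡canonical b)))

module RationalPolynomial where

  open import Data.Rational as ℚ using (0ℚ; 1ℚ; _/_) renaming (_+_ to _+ℚ_; _*_ to _*ℚ_; -_ to -ℚ_)
  import Data.Rational.Properties as ℚ
  open import Data.Rational.Solver using (module +-*-Solver)
  open import Data.Nat using (s≤s)
  open import Data.List.Relation.Unary.All using ([]; _∷_)
  open import Algebra.Structures using (IsCommutativeRing)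
  open import Relation.Binary.PropositionalEquality
  open +-*-Solver using (solve; _:+_; _:*_; _:=_; con)
  open IntegerToRational
  open IntegerPolynomial using (monic)

  coeff : List ℚ → ℕ → ℚ
  coeff [] k = 0ℚ
  coeff (a ∷ as) zero = a
  coeff (a ∷ as) (suc k) = coeff as k

  infix 4 _≋_
  record _≋_ (p q : List ℚ) : Set where
    constructor coeffwise
    field at : ∀ k → coeff p k ≡ coeff q k
  open _≋_

  ≋-refl : ∀ {p} → p ≋ p
  ≋-refl = coeffwise (λ _ → refl)

  ≋-sym : ∀ {p q} → p ≋ q → q ≋ p
  ≋-sym p≋q = coeffwise (λ k → sym (at p≋q k))

  ≋-trans : ∀ {p q r} → p ≋ q → q ≋ r → p ≋ r
  ≋-trans p≋q q≋r = coeffwise (λ k → trans (at p≋q k) (at q≋r k))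

  ≡⇒≋ : ∀ {p q} → p ≡ q → p ≋ q
  ≡⇒≋ refl = ≋-refl

  ∷-cong : ∀ {a b p q} → a ≡ b → p ≋ q → a ∷ p ≋ b ∷ q
  ∷-cong a≡b p≋q = coeffwise λ { zero → a≡b ; (suc k) → at p≋q k }

  coeff-addP : ∀ p q k → coeff (addP p q) k ≡ coeff p k +ℚ coeff q k
  coeff-addP [] q k = sym (ℚ.+-identityˡ _)
  coeff-addP (a ∷ p) [] k = sym (ℚ.+-identityʳ _)
  coeff-addP (a ∷ p) (b ∷ q) zero = refl
  coeff-addP (a ∷ p) (b ∷ q) (suc k) = coeff-addP p q k

  coeff-negP : ∀ p k → coeff (negP p) k ≡ -ℚ coeff p k
  coeff-negP [] k = refl
  coeff-negP (a ∷ p) zero = refl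
  coeff-negP (a ∷ p) (suc k) = coeff-negP p k

  coeff-scaleP : ∀ c p k → coeff (scaleP c p) k ≡ c *ℚ coeff p k
  coeff-scaleP c [] k = sym (ℚ.*-zeroʳ c)
  coeff-scaleP c (a ∷ p) zero = refl
  coeff-scaleP c (a ∷ p) (suc k) = coeff-scaleP c p k

  coeff-subP : ∀ p q k → coeff (subP p q) k ≡ coeff p k +ℚ -ℚ coeff q k
  coeff-subP p q k = trans (coeff-addP p (negP q) k) (cong (coeff p k +ℚ_) (coeff-negP q k))

  coeff-mulP : ∀ a p q k → coeff (mulP (a ∷ p) q) k ≡ a *ℚ coeff q k +ℚ coeff (0ℚ ∷ mulP p q) k
  coeff-mulP a p q k = trans (coeff-addP (scaleP a q) _ k) (cong (_+ℚ _) (coeff-scaleP a q k))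

  coeff-monic-top : ∀ cs → coeff (toℚP (monic cs)) (length cs) ≡ 1ℚ
  coeff-monic-top [] = refl
  coeff-monic-top (c ∷ cs) = coeff-monic-top cs

  coeff-monic-above : ∀ cs {n} → length cs ℕ.< n → coeff (toℚP (monic cs)) n ≡ 0ℚ
  coeff-monic-above [] {suc n} _ = refl
  coeff-monic-above (c ∷ cs) {suc n} (s≤s cs<n) = coeff-monic-above cs cs<n

  IsZeroP⇒coeff : ∀ {p} → IsZeroP p → ∀ k → coeff p k ≡ 0ℚ
  IsZeroP⇒coeff [] k = refl
  IsZeroP⇒coeff (a≡0 ∷ _) zero = a≡0
  IsZeroP⇒coeff (_ ∷ p≡0) (suc k) = IsZeroP⇒coeff p≡0 k

  coeff⇒IsZeroP : ∀ p → (∀ k → coeff p k ≡ 0ℚ) → IsZeroP p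
  coeff⇒IsZeroP [] _ = []
  coeff⇒IsZeroP (a ∷ p) p≡0 = p≡0 zero ∷ coeff⇒IsZeroP p (λ k → p≡0 (suc k))

  ≈P⇒≋ : ∀ {p q} → p ≈P q → p ≋ q
  ≈P⇒≋ {p} {q} p-q≡0 = coeffwise λ k → x∙y⁻¹≈ε⇒x≈y _ _ (trans (sym (coeff-subP p q k)) (IsZeroP⇒coeff p-q≡0 k))
    where open import Algebra.Properties.Group ℚ.+-0-group using (x∙y⁻¹≈ε⇒x≈y)

  ≋⇒≈P : ∀ {p q} → p ≋ q → p ≈P q
  ≋⇒≈P {p} {q} p≋q = coeff⇒IsZeroP (subP p q) λ k →
    trans (coeff-subP p q k) (trans (cong (λ c → c +ℚ -ℚ coeff q k) (at p≋q k)) (ℚ.+-inverseʳ (coeff q k)))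

  addP-cong : ∀ {p p′ q q′} → p ≋ p′ → q ≋ q′ → addP p q ≋ addP p′ q′
  addP-cong {p} {p′} {q} {q′} p≋p′ q≋q′ = coeffwise λ k →
    trans (coeff-addP p q k) (trans (cong₂ _+ℚ_ (at p≋p′ k) (at q≋q′ k)) (sym (coeff-addP p′ q′ k)))

  negP-cong : ∀ {p p′} → p ≋ p′ → negP p ≋ negP p′
  negP-cong {p} {p′} p≋p′ = coeffwise λ k →
    trans (coeff-negP p k) (trans (cong -ℚ_ (at p≋p′ k)) (sym (coeff-negP p′ k)))

  scaleP-congʳ : ∀ c {p p′} → p ≋ p′ → scaleP c p ≋ scaleP c p′
  scaleP-congʳ c {p} {p′} p≋p′ = coeffwise λ k →
    trans (coeff-scaleP c p k) (trans (cong (c *ℚ_) (at p≋p′ k)) (sym (coeff-scaleP c p′ k)))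

  mulP-congʳ : ∀ p {q q′} → q ≋ q′ → mulP p q ≋ mulP p q′
  mulP-congʳ [] _ = ≋-refl
  mulP-congʳ (a ∷ p) q≋q′ = addP-cong (scaleP-congʳ a q≋q′) (∷-cong refl (mulP-congʳ p q≋q′))

  [0]≋[] : 0ℚ ∷ [] ≋ []
  [0]≋[] = coeffwise λ { zero → refl ; (suc k) → refl }

  mulP-zeroˡ : ∀ p q → p ≋ [] → mulP p q ≋ []
  mulP-zeroˡ [] q _ = ≋-refl
  mulP-zeroˡ (a ∷ p) q p≋0 = coeffwise λ k → trans (coeff-mulP a p q k) (trans (cong₂ _+ℚ_
    (trans (cong (_*ℚ coeff q k) (at p≋0 zero)) (ℚ.*-zeroˡ (coeff q k)))
    (at (≋-trans (∷-cong refl (mulP-zeroˡ p q (coeffwise λ j → at p≋0 (suc j)))) [0]≋[]) k)) (ℚ.+-identityʳ 0ℚ))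

  mulP-congˡ : ∀ {p p′} q → p ≋ p′ → mulP p q ≋ mulP p′ q
  mulP-congˡ {[]} {[]} q _ = ≋-refl
  mulP-congˡ {[]} {_ ∷ _} q p≋p′ = ≋-sym (mulP-zeroˡ _ q (≋-sym p≋p′))
  mulP-congˡ {_ ∷ _} {[]} q p≋p′ = mulP-zeroˡ _ q p≋p′
  mulP-congˡ {a ∷ p} {a′ ∷ p′} q ap≋ap′ = addP-cong
    (coeffwise λ k → trans (coeff-scaleP a q k) (trans (cong (_*ℚ coeff q k) (at ap≋ap′ zero)) (sym (coeff-scaleP a′ q k))))
    (∷-cong refl (mulP-congˡ {p} {p′} q (coeffwise λ k → at ap≋ap′ (suc k))))

  addP-comm : ∀ p q → addP p q ≋ addP q p
  addP-comm p q = coeffwise λ k → trans (coeff-addP p q k) (trans (ℚ.+-comm (coeff p k) (coeff q k)) (sym (coeff-addP q p k)))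

  addP-assoc : ∀ p q r → addP (addP p q) r ≋ addP p (addP q r)
  addP-assoc p q r = coeffwise λ k → begin
    coeff (addP (addP p q) r) k               ≡⟨ trans (coeff-addP (addP p q) r k) (cong (_+ℚ coeff r k) (coeff-addP p q k)) ⟩
    coeff p k +ℚ coeff q k +ℚ coeff r k       ≡⟨ ℚ.+-assoc (coeff p k) (coeff q k) (coeff r k) ⟩
    coeff p k +ℚ (coeff q k +ℚ coeff r k)     ≡⟨ sym (trans (coeff-addP p (addP q r) k) (cong (coeff p k +ℚ_) (coeff-addP q r k))) ⟩
    coeff (addP p (addP q r)) k               ∎
    where open ≡-Reasoning

  addP-identityʳ : ∀ p → addP p [] ≋ p
  addP-identityʳ p = addP-comm p []

  addP-inverseˡ : ∀ p → addP (negP p) p ≋ []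
  addP-inverseˡ p = coeffwise λ k →
    trans (coeff-addP (negP p) p k) (trans (cong (_+ℚ coeff p k) (coeff-negP p k)) (ℚ.+-inverseˡ (coeff p k)))

  addP-inverseʳ : ∀ p → addP p (negP p) ≋ []
  addP-inverseʳ p = ≋-trans (addP-comm p (negP p)) (addP-inverseˡ p)

  coeffwise-step : ∀ {p q} → coeff p zero ≡ coeff q zero → (∀ k → coeff p (suc k) ≡ coeff q (suc k)) → p ≋ q
  coeffwise-step eq₀ eqₛ = coeffwise λ { zero → eq₀ ; (suc k) → eqₛ k }

  mulP-distribʳ : ∀ p q r → mulP (addP p q) r ≋ addP (mulP p r) (mulP q r)
  mulP-distribʳ [] q r = ≋-refl
  mulP-distribʳ (a ∷ p) [] r = ≋-sym (addP-identityʳ _)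
  mulP-distribʳ (a ∷ p) (b ∷ q) r = coeffwise-step
    (begin
      coeff (mulP (a +ℚ b ∷ addP p q) r) zero ≡⟨ coeff-mulP (a +ℚ b) (addP p q) r zero ⟩
      (a +ℚ b) *ℚ r₀ +ℚ 0ℚ                   ≡⟨ solve 3 (λ a b r → (a :+ b) :* r :+ con 0ℚ := (a :* r :+ con 0ℚ) :+ (b :* r :+ con 0ℚ)) refl a b r₀ ⟩
      (a *ℚ r₀ +ℚ 0ℚ) +ℚ (b *ℚ r₀ +ℚ 0ℚ)      ≡⟨ sym (sum-of-products zero) ⟩
      coeff (addP (mulP (a ∷ p) r) (mulP (b ∷ q) r)) zero ∎)
    (λ k → begin
      coeff (mulP (a +ℚ b ∷ addP p q) r) (suc k)  ≡⟨ coeff-mulP (a +ℚ b) (addP p q) r (suc k) ⟩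
      (a +ℚ b) *ℚ coeff r (suc k) +ℚ coeff (mulP (addP p q) r) k
        ≡⟨ cong ((a +ℚ b) *ℚ coeff r (suc k) +ℚ_) (trans (at (mulP-distribʳ p q r) k) (coeff-addP (mulP p r) (mulP q r) k)) ⟩
      (a +ℚ b) *ℚ coeff r (suc k) +ℚ (coeff (mulP p r) k +ℚ coeff (mulP q r) k)
        ≡⟨ solve 5 (λ a b r u v → (a :+ b) :* r :+ (u :+ v) := (a :* r :+ u) :+ (b :* r :+ v)) refl a b (coeff r (suc k)) _ _ ⟩
      (a *ℚ coeff r (suc k) +ℚ coeff (mulP p r) k) +ℚ (b *ℚ coeff r (suc k) +ℚ coeff (mulP q r) k)
        ≡⟨ sym (sum-of-products (suc k)) ⟩
      coeff (addP (mulP (a ∷ p) r) (mulP (b ∷ q) r)) (suc k) ∎)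
    where
    open ≡-Reasoning
    r₀ : ℚ
    r₀ = coeff r zero
    sum-of-products : ∀ k → coeff (addP (mulP (a ∷ p) r) (mulP (b ∷ q) r)) k ≡
                            (a *ℚ coeff r k +ℚ coeff (0ℚ ∷ mulP p r) k) +ℚ (b *ℚ coeff r k +ℚ coeff (0ℚ ∷ mulP q r) k)
    sum-of-products k = trans (coeff-addP (mulP (a ∷ p) r) _ k) (cong₂ _+ℚ_ (coeff-mulP a p r k) (coeff-mulP b q r k))

  mulP-scaleˡ : ∀ c p q → mulP (scaleP c p) q ≋ scaleP c (mulP p q)
  mulP-scaleˡ c [] q = ≋-refl
  mulP-scaleˡ c (a ∷ p) q = coeffwise-step
    (begin
      coeff (mulP (c *ℚ a ∷ scaleP c p) q) zero     ≡⟨ coeff-mulP (c *ℚ a) (scaleP c p) q zero ⟩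
      c *ℚ a *ℚ q₀ +ℚ 0ℚ                            ≡⟨ solve 3 (λ c a q → c :* a :* q :+ con 0ℚ := c :* (a :* q :+ con 0ℚ)) refl c a q₀ ⟩
      c *ℚ (a *ℚ q₀ +ℚ 0ℚ)                          ≡⟨ sym (scaled-product zero) ⟩
      coeff (scaleP c (mulP (a ∷ p) q)) zero        ∎)
    (λ k → begin
      coeff (mulP (c *ℚ a ∷ scaleP c p) q) (suc k)  ≡⟨ coeff-mulP (c *ℚ a) (scaleP c p) q (suc k) ⟩
      c *ℚ a *ℚ coeff q (suc k) +ℚ coeff (mulP (scaleP c p) q) k
        ≡⟨ cong (c *ℚ a *ℚ coeff q (suc k) +ℚ_) (trans (at (mulP-scaleˡ c p q) k) (coeff-scaleP c (mulP p q) k)) ⟩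
      c *ℚ a *ℚ coeff q (suc k) +ℚ c *ℚ coeff (mulP p q) k
        ≡⟨ solve 4 (λ c a q u → c :* a :* q :+ c :* u := c :* (a :* q :+ u)) refl c a (coeff q (suc k)) (coeff (mulP p q) k) ⟩
      c *ℚ (a *ℚ coeff q (suc k) +ℚ coeff (mulP p q) k) ≡⟨ sym (scaled-product (suc k)) ⟩
      coeff (scaleP c (mulP (a ∷ p) q)) (suc k)     ∎)
    where
    open ≡-Reasoning
    q₀ : ℚ
    q₀ = coeff q zero
    scaled-product : ∀ k → coeff (scaleP c (mulP (a ∷ p) q)) k ≡ c *ℚ (a *ℚ coeff q k +ℚ coeff (0ℚ ∷ mulP p q) k)
    scaled-product k = trans (coeff-scaleP c (mulP (a ∷ p) q) k) (cong (c *ℚ_) (coeff-mulP a p q k))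

  mulP-shiftˡ : ∀ p q → mulP (0ℚ ∷ p) q ≋ 0ℚ ∷ mulP p q
  mulP-shiftˡ p q = coeffwise λ k → trans (coeff-mulP 0ℚ p q k)
    (trans (cong (_+ℚ coeff (0ℚ ∷ mulP p q) k) (ℚ.*-zeroˡ (coeff q k))) (ℚ.+-identityˡ _))

  mulP-assoc : ∀ p q r → mulP (mulP p q) r ≋ mulP p (mulP q r)
  mulP-assoc [] q r = ≋-refl
  mulP-assoc (a ∷ p) q r = ≋-trans (mulP-distribʳ (scaleP a q) (0ℚ ∷ mulP p q) r)
    (addP-cong (mulP-scaleˡ a q r) (≋-trans (mulP-shiftˡ (mulP p q) r) (∷-cong refl (mulP-assoc p q r))))

  mulP-zeroʳ : ∀ p → mulP p [] ≋ []
  mulP-zeroʳ [] = ≋-refl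
  mulP-zeroʳ (a ∷ p) = ≋-trans (∷-cong refl (mulP-zeroʳ p)) [0]≋[]

  mulP-consʳ : ∀ p b q → mulP p (b ∷ q) ≋ addP (scaleP b p) (0ℚ ∷ mulP p q)
  mulP-consʳ [] b q = ≋-sym [0]≋[]
  mulP-consʳ (a ∷ p) b q = coeffwise-step
    (trans (coeff-mulP a p (b ∷ q) zero) (trans (solve 2 (λ a b → a :* b :+ con 0ℚ := b :* a :+ con 0ℚ) refl a b)
      (sym (coeff-addP (scaleP b (a ∷ p)) (0ℚ ∷ mulP (a ∷ p) q) zero))))
    (λ k → begin
      coeff (mulP (a ∷ p) (b ∷ q)) (suc k)                    ≡⟨ coeff-mulP a p (b ∷ q) (suc k) ⟩
      a *ℚ coeff q k +ℚ coeff (mulP p (b ∷ q)) k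
        ≡⟨ cong (a *ℚ coeff q k +ℚ_) (trans (at (mulP-consʳ p b q) k) (trans (coeff-addP (scaleP b p) _ k) (cong (_+ℚ _) (coeff-scaleP b p k)))) ⟩
      a *ℚ coeff q k +ℚ (b *ℚ coeff p k +ℚ coeff (0ℚ ∷ mulP p q) k)
        ≡⟨ solve 5 (λ a b q p u → a :* q :+ (b :* p :+ u) := b :* p :+ (a :* q :+ u)) refl a b (coeff q k) (coeff p k) _ ⟩
      b *ℚ coeff p k +ℚ (a *ℚ coeff q k +ℚ coeff (0ℚ ∷ mulP p q) k)
        ≡⟨ sym (trans (coeff-addP (scaleP b (a ∷ p)) (0ℚ ∷ mulP (a ∷ p) q) (suc k)) (cong₂ _+ℚ_ (coeff-scaleP b p k) (coeff-mulP a p q k))) ⟩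
      coeff (addP (scaleP b (a ∷ p)) (0ℚ ∷ mulP (a ∷ p) q)) (suc k) ∎)
    where open ≡-Reasoning

  mulP-comm : ∀ p q → mulP p q ≋ mulP q p
  mulP-comm [] q = ≋-sym (mulP-zeroʳ q)
  mulP-comm (a ∷ p) q = ≋-trans (addP-cong ≋-refl (∷-cong refl (mulP-comm p q))) (≋-sym (mulP-consʳ q a p))

  mulP-identityˡ : ∀ p → mulP (1ℚ ∷ []) p ≋ p
  mulP-identityˡ p = coeffwise λ k → trans (coeff-mulP 1ℚ [] p k)
    (trans (cong₂ _+ℚ_ (ℚ.*-identityˡ (coeff p k)) (at [0]≋[] k)) (ℚ.+-identityʳ _))

  X : List ℚ
  X = 0ℚ ∷ 1ℚ ∷ []

  X-* : ∀ q → mulP X q ≋ 0ℚ ∷ q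
  X-* q = ≋-trans (mulP-shiftˡ (1ℚ ∷ []) q) (∷-cong refl (mulP-identityˡ q))

  ℚ[x]-isCommutativeRing : IsCommutativeRing _≋_ addP mulP negP [] (1ℚ ∷ [])
  ℚ[x]-isCommutativeRing = record
    { isRing = record
      { +-isAbelianGroup = record
        { isGroup = record
          { isMonoid = record
            { isSemigroup = record
              { isMagma = record { isEquivalence = record { refl = ≋-refl ; sym = ≋-sym ; trans = ≋-trans } ; ∙-cong = addP-cong }
              ; assoc = addP-assoc }
            ; identity = (λ _ → ≋-refl) , addP-identityʳ }
          ; inverse = addP-inverseˡ , addP-inverseʳ
          ; ⁻¹-cong = negP-cong }
        ; comm = addP-comm }
      ; *-cong = λ {p} {p′} {q} p≋p′ q≋q′ → ≋-trans (mulP-congˡ q p≋p′) (mulP-congʳ p′ q≋q′)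
      ; *-assoc = mulP-assoc
      ; *-identity = mulP-identityˡ , λ p → ≋-trans (mulP-comm p _) (mulP-identityˡ p)
      ; distrib = (λ p q r → ≋-trans (mulP-comm p _) (≋-trans (mulP-distribʳ q r p) (addP-cong (mulP-comm q p) (mulP-comm r p))))
                , (λ p q r → mulP-distribʳ q r p) }
    ; *-comm = mulP-comm }

  ℚ[x] : CommutativeRing 0ℓ 0ℓ
  ℚ[x] = record { isCommutativeRing = ℚ[x]-isCommutativeRing }

  constant : ℤ → List ℚ
  constant z = toℚP (z ∷ [])

  constant-isRingHomomorphism : IsRingHomomorphism ℤ.+-*-rawRing (CommutativeRing.rawRing ℚ[x]) constant
  constant-isRingHomomorphism = record
    { isSemiringHomomorphism = record
      { isNearSemiringHomomorphism = record
        { +-isMonoidHomomorphism = record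
          { isMagmaHomomorphism = record
            { isRelHomomorphism = record { cong = λ { refl → ≋-refl } }
            ; homo = λ a b → ∷-cong (/1-+ a b) ≋-refl }
          ; ε-homo = [0]≋[] }
        ; *-homo = λ a b → ∷-cong (trans (/1-* a b) (sym (ℚ.+-identityʳ _))) ≋-refl }
      ; 1#-homo = ≋-refl }
    ; -‿homo = λ a → ∷-cong (/1-neg a) ≋-refl }

  coeff-constant-* : ∀ z q n → coeff (mulP (constant z) q) n ≡ (z / 1) *ℚ coeff q n
  coeff-constant-* z q n = trans (coeff-mulP (z / 1) [] q n) (trans (cong ((z / 1) *ℚ coeff q n +ℚ_) (at [0]≋[] n)) (ℚ.+-identityʳ _))

  -- Opaque: unfolding the normalised rational 1/z makes conversion checking blow up.
  opaque
    constant-inverse : ∀ z → z ≢ + 0 → ∃ λ w → mulP w (constant z) ≋ 1ℚ ∷ []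
    constant-inverse z z≢0 = (ℚ.1/ (z / 1)) ∷ [] , ∷-cong (trans (ℚ.+-identityʳ _) (ℚ.*-inverseˡ (z / 1))) ≋-refl
      where instance
      z/1≢0 : ℚ.NonZero (z / 1)
      z/1≢0 = ℚ.≢-nonZero (λ z/1≡0 → z≢0 (/1-injective z/1≡0))

module QuotientRing (g : List ℚ) where

  open RationalPolynomial
  open CommutativeRing ℚ[x] using (setoid)
  open IntegerRingSolver ℚ[x] constant constant-isRingHomomorphism
  open import Relation.Binary.Reasoning.Setoid setoid
  open import Algebra.Structures using (IsCommutativeRing)

  infix 4 _~_
  record _~_ (p q : List ℚ) : Set where
    constructor multiple
    field
      quotient : List ℚ
      quotient-eq : mulP quotient g ≋ subP p q

  ≋⇒~ : ∀ {p q} → p ≋ q → p ~ q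
  ≋⇒~ {p} {q} p≋q = multiple [] (≋-sym (≋-trans (addP-cong p≋q ≋-refl) (addP-inverseʳ q)))

  ~-refl : ∀ {p} → p ~ p
  ~-refl = ≋⇒~ ≋-refl

  ~-sym : ∀ {p q} → p ~ q → q ~ p
  ~-sym {p} {q} (multiple r eq) = multiple (negP r) (begin
    mulP (negP r) g  ≈⟨ solve 2 (λ r g → (:- r) :* g := :- (r :* g)) ≋-refl r g ⟩
    negP (mulP r g)  ≈⟨ negP-cong eq ⟩
    negP (subP p q)  ≈⟨ solve 2 (λ p q → :- (p :- q) := q :- p) ≋-refl p q ⟩
    subP q p         ∎)

  ~-trans : ∀ {p q r} → p ~ q → q ~ r → p ~ r
  ~-trans {p} {q} {r} (multiple s eq) (multiple t eq′) = multiple (addP s t) (begin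
    mulP (addP s t) g               ≈⟨ mulP-distribʳ s t g ⟩
    addP (mulP s g) (mulP t g)      ≈⟨ addP-cong eq eq′ ⟩
    addP (subP p q) (subP q r)      ≈⟨ solve 3 (λ p q r → (p :- q) :+ (q :- r) := p :- r) ≋-refl p q r ⟩
    subP p r                        ∎)

  ~-+ : ∀ {p p′ q q′} → p ~ p′ → q ~ q′ → addP p q ~ addP p′ q′
  ~-+ {p} {p′} {q} {q′} (multiple s eq) (multiple t eq′) = multiple (addP s t) (begin
    mulP (addP s t) g                    ≈⟨ mulP-distribʳ s t g ⟩
    addP (mulP s g) (mulP t g)           ≈⟨ addP-cong eq eq′ ⟩
    addP (subP p p′) (subP q q′)         ≈⟨ solve 4 (λ p p′ q q′ → (p :- p′) :+ (q :- q′) := (p :+ q) :- (p′ :+ q′)) ≋-refl p p′ q q′ ⟩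
    subP (addP p q) (addP p′ q′)         ∎)

  ~-neg : ∀ {p p′} → p ~ p′ → negP p ~ negP p′
  ~-neg {p} {p′} (multiple s eq) = multiple (negP s) (begin
    mulP (negP s) g    ≈⟨ solve 2 (λ s g → (:- s) :* g := :- (s :* g)) ≋-refl s g ⟩
    negP (mulP s g)    ≈⟨ negP-cong eq ⟩
    negP (subP p p′)   ≈⟨ solve 2 (λ p p′ → :- (p :- p′) := (:- p) :- (:- p′)) ≋-refl p p′ ⟩
    subP (negP p) (negP p′) ∎)

  ~-* : ∀ {p p′ q q′} → p ~ p′ → q ~ q′ → mulP p q ~ mulP p′ q′
  ~-* {p} {p′} {q} {q′} (multiple s eq) (multiple t eq′) = multiple (addP (mulP s q) (mulP p′ t)) (begin
    mulP (addP (mulP s q) (mulP p′ t)) g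
      ≈⟨ solve 5 (λ s q p′ t g → (s :* q :+ p′ :* t) :* g := (s :* g) :* q :+ p′ :* (t :* g)) ≋-refl s q p′ t g ⟩
    addP (mulP (mulP s g) q) (mulP p′ (mulP t g))
      ≈⟨ addP-cong (mulP-congˡ q eq) (mulP-congʳ p′ eq′) ⟩
    addP (mulP (subP p p′) q) (mulP p′ (subP q q′))
      ≈⟨ solve 4 (λ p p′ q q′ → (p :- p′) :* q :+ p′ :* (q :- q′) := p :* q :- p′ :* q′) ≋-refl p p′ q q′ ⟩
    subP (mulP p q) (mulP p′ q′) ∎)

  K-isCommutativeRing : IsCommutativeRing _~_ addP mulP negP [] (1ℚ ∷ [])
  K-isCommutativeRing = record
    { isRing = record
      { +-isAbelianGroup = record
        { isGroup = record
          { isMonoid = record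
            { isSemigroup = record
              { isMagma = record { isEquivalence = record { refl = ~-refl ; sym = ~-sym ; trans = ~-trans } ; ∙-cong = ~-+ }
              ; assoc = λ p q r → ≋⇒~ (+-assoc p q r) }
            ; identity = (λ p → ≋⇒~ (+-identityˡ p)) , (λ p → ≋⇒~ (+-identityʳ p)) }
          ; inverse = (λ p → ≋⇒~ (-‿inverseˡ p)) , (λ p → ≋⇒~ (-‿inverseʳ p))
          ; ⁻¹-cong = ~-neg }
        ; comm = λ p q → ≋⇒~ (+-comm p q) }
      ; *-cong = ~-*
      ; *-assoc = λ p q r → ≋⇒~ (*-assoc p q r)
      ; *-identity = (λ p → ≋⇒~ (*-identityˡ p)) , (λ p → ≋⇒~ (*-identityʳ p))
      ; distrib = (λ p q r → ≋⇒~ (distribˡ p q r)) , (λ p q r → ≋⇒~ (distribʳ p q r)) }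
    ; *-comm = λ p q → ≋⇒~ (*-comm p q) }
    where open CommutativeRing ℚ[x] using (+-assoc; +-identityˡ; +-identityʳ; -‿inverseˡ; -‿inverseʳ; +-comm;
                                          *-assoc; *-identityˡ; *-identityʳ; distribˡ; distribʳ; *-comm)

  K : CommutativeRing 0ℓ 0ℓ
  K = record { isCommutativeRing = K-isCommutativeRing }

  constant-isRingHomomorphismᴷ : IsRingHomomorphism ℤ.+-*-rawRing (CommutativeRing.rawRing K) constant
  constant-isRingHomomorphismᴷ = record
    { isSemiringHomomorphism = record
      { isNearSemiringHomomorphism = record
        { +-isMonoidHomomorphism = record
          { isMagmaHomomorphism = record
            { isRelHomomorphism = record { cong = λ a≡b → ≋⇒~ (⟦⟧-cong a≡b) }
            ; homo = λ a b → ≋⇒~ (+-homo a b) }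
          ; ε-homo = ≋⇒~ 0#-homo }
        ; *-homo = λ a b → ≋⇒~ (*-homo a b) }
      ; 1#-homo = ≋⇒~ 1#-homo }
    ; -‿homo = λ a → ≋⇒~ (-‿homo a) }
    where open IsRingHomomorphism constant-isRingHomomorphism

  constant-cancel : ∀ {z x} → z ≢ + 0 → mulP (constant z) x ~ [] → x ~ []
  constant-cancel {z} {x} z≢0 zx~0 = trans (sym (trans (*-congʳ {x} (≋⇒~ w*z≋1)) (*-identityˡ x)))
    (trans (*-assoc w (constant z) x) (trans (*-congˡ {w} zx~0) (zeroʳ w)))
    where
    open CommutativeRing K using (trans; sym; *-congʳ; *-congˡ; *-assoc; *-identityˡ; zeroʳ)
    w : List ℚ
    w = proj₁ (constant-inverse z z≢0)
    w*z≋1 : mulP w (constant z) ≋ 1ℚ ∷ []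
    w*z≋1 = proj₂ (constant-inverse z z≢0)

  ~⇒DividesP : ∀ {p q} → p ~ q → DividesP g (subP p q)
  ~⇒DividesP (multiple r eq) = r , ≋⇒≈P eq

  DividesP⇒~ : ∀ {p q} → DividesP g (subP p q) → p ~ q
  DividesP⇒~ (r , eq) = multiple r (≈P⇒≋ eq)

module ListCounting where

  open import Data.Nat using (z≤n; s≤s)
  open import Data.List using (filter)
  open import Data.List.Properties using (length-++)
  open import Data.List.Membership.Propositional using (_∈_)
  open import Data.List.Membership.Propositional.Properties using (∈-∃++; ∈-++⁻; ∈-++⁺ˡ; ∈-++⁺ʳ)
  open import Data.List.Relation.Unary.Unique.Propositional using (Unique; _∷_)
  import Data.List.Relation.Unary.All as All
  open import Data.List.Relation.Unary.Any using (here; there)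
  open import Data.Sum using (inj₁; inj₂)
  open import Relation.Nullary using (¬?; contradiction)
  open import Relation.Unary using (Decidable)
  open import Relation.Binary.PropositionalEquality

  unique⊆⇒length≤ : ∀ {A : Set} {xs ys : List A} → Unique xs → (∀ {z} → z ∈ xs → z ∈ ys) → length xs ℕ.≤ length ys
  unique⊆⇒length≤ {xs = []} _ _ = z≤n
  unique⊆⇒length≤ {xs = x ∷ xs} {ys} (x∉xs ∷ xs!) xs⊆ys with ∈-∃++ (xs⊆ys (here refl))
  ... | ys₁ , ys₂ , refl = ℕ.≤-trans (s≤s (unique⊆⇒length≤ xs! shrink)) (ℕ.≤-reflexive (sym length-split))
    where
    shrink : ∀ {z} → z ∈ xs → z ∈ ys₁ ++ ys₂
    shrink {z} z∈xs with ∈-++⁻ ys₁ (xs⊆ys (there z∈xs))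
    ... | inj₁ z∈ys₁ = ∈-++⁺ˡ z∈ys₁
    ... | inj₂ (here refl) = contradiction refl (All.lookup x∉xs z∈xs)
    ... | inj₂ (there z∈ys₂) = ∈-++⁺ʳ ys₁ z∈ys₂
    length-split : length (ys₁ ++ x ∷ ys₂) ≡ suc (length (ys₁ ++ ys₂))
    length-split = trans (length-++ ys₁) (trans (ℕ.+-suc (length ys₁) _) (cong suc (sym (length-++ ys₁))))

  length-filter-split : ∀ {A : Set} {P : A → Set} (P? : Decidable P) xs →
    length (filter P? xs) ℕ.+ length (filter (λ y → ¬? (P? y)) xs) ≡ length xs
  length-filter-split P? [] = refl
  length-filter-split P? (x ∷ xs) with P? x
  ... | yes _ = cong suc (length-filter-split P? xs)
  ... | no _ = trans (ℕ.+-suc _ _) (cong suc (length-filter-split P? xs))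

module CyclicAction {m : ℕ} (σ : Fin m → Fin m) (p : ℕ) .{{_ : ℕ.NonZero p}}
  (period : ∀ x → fold x σ p ≡ x) (free : ∀ x k → fold x σ k ≡ x → p ∣ k) where

  open import Data.Nat using (_<_; z≤n; s≤s)
  open import Data.Nat.Divisibility using (>⇒∤; ∣m∣n⇒∣m+n; ∣-refl; _∣0)
  open import Data.List using (tabulate; filter; allFin)
  open import Data.List.Properties using (length-tabulate)
  open import Data.List.Membership.Propositional using (_∈_; _∉_)
  open import Data.List.Membership.Propositional.Properties using (∈-tabulate⁺; ∈-tabulate⁻; ∈-filter⁺; ∈-filter⁻; ∈-allFin)
  open import Data.List.Membership.DecPropositional (Fin._≟_ {m}) using (_∈?_)
  open import Data.List.Relation.Unary.Unique.Propositional using (Unique)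
  import Data.List.Relation.Unary.Unique.Propositional.Properties as Unique
  open import Data.List.Relation.Unary.Any using (here)
  open import Data.Sum using (inj₁; inj₂)
  open import Relation.Nullary using (¬?; contradiction)
  open import Relation.Unary using (Decidable)
  open import Relation.Binary.PropositionalEquality
  open import Function using (id)
  open ListCounting

  fold-σ : ∀ x k → fold (σ x) σ k ≡ σ (fold x σ k)
  fold-σ x k = trans (sym (fold-+ x σ k {1})) (cong (fold x σ) (ℕ.+-comm k 1))

  σ-injective : ∀ {x y} → σ x ≡ σ y → x ≡ y
  σ-injective {x} {y} σx≡σy = begin
    x                      ≡⟨ period x ⟨
    fold x σ p             ≡⟨ cong (fold x σ) (ℕ.suc-pred p) ⟨
    σ (fold x σ (ℕ.pred p)) ≡⟨ fold-σ x (ℕ.pred p) ⟨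
    fold (σ x) σ (ℕ.pred p) ≡⟨ cong (λ z → fold z σ (ℕ.pred p)) σx≡σy ⟩
    fold (σ y) σ (ℕ.pred p) ≡⟨ trans (fold-σ y (ℕ.pred p)) (cong (fold y σ) (ℕ.suc-pred p)) ⟩
    fold y σ p             ≡⟨ period y ⟩
    y                      ∎
    where open ≡-Reasoning

  multiple-below-period : ∀ {d} → d < p → p ∣ d → d ≡ 0
  multiple-below-period {zero} _ _ = refl
  multiple-below-period {suc d} d<p p∣d = contradiction p∣d (>⇒∤ d<p)

  fold-injective-below : ∀ x {i j} → i ℕ.≤ j → j < p → fold x σ i ≡ fold x σ j → i ≡ j
  fold-injective-below x {i} {j} i≤j j<p eq = begin
    i                ≡⟨ cong (ℕ._+ i) (multiple-below-period (ℕ.≤-<-trans (ℕ.m∸n≤m j i) j<p) (free (fold x σ i) (j ℕ.∸ i) returns)) ⟨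
    (j ℕ.∸ i) ℕ.+ i  ≡⟨ ℕ.m∸n+n≡m i≤j ⟩
    j                ∎
    where
    open ≡-Reasoning
    returns : fold (fold x σ i) σ (j ℕ.∸ i) ≡ fold x σ i
    returns = trans (sym (fold-+ x σ (j ℕ.∸ i))) (trans (cong (fold x σ) (ℕ.m∸n+n≡m i≤j)) (sym eq))

  orbit : Fin m → List (Fin m)
  orbit x = tabulate {n = p} (λ k → fold x σ (toℕ k))

  orbit-unique : ∀ x → Unique (orbit x)
  orbit-unique x = Unique.tabulate⁺ injective
    where
    injective : ∀ {i j : Fin p} → fold x σ (toℕ i) ≡ fold x σ (toℕ j) → i ≡ j
    injective {i} {j} eq with ℕ.≤-total (toℕ i) (toℕ j)
    ... | inj₁ i≤j = Fin.toℕ-injective (fold-injective-below x i≤j (Fin.toℕ<n j) eq)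
    ... | inj₂ j≤i = Fin.toℕ-injective (sym (fold-injective-below x j≤i (Fin.toℕ<n i) (sym eq)))

  length-orbit : ∀ x → length (orbit x) ≡ p
  length-orbit x = length-tabulate _

  ∈-orbit : ∀ x {k} → k < p → fold x σ k ∈ orbit x
  ∈-orbit x k<p = subst (_∈ orbit x) (cong (fold x σ) (Fin.toℕ-fromℕ< k<p)) (∈-tabulate⁺ (Fin.fromℕ< k<p))

  σ⁻¹-orbit : ∀ x {y} → σ y ∈ orbit x → y ∈ orbit x
  σ⁻¹-orbit x {y} σy∈ with ∈-tabulate⁻ σy∈
  ... | k , σy≡ with toℕ k in k≡
  ...   | zero = subst (_∈ orbit x) (σ-injective (sym (trans σy≡ (trans (sym (period x)) σ-last))))
                         (∈-orbit x (ℕ.<-≤-trans (ℕ.n<1+n (ℕ.pred p)) (ℕ.≤-reflexive (ℕ.suc-pred p))))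
    where
    σ-last : fold x σ p ≡ σ (fold x σ (ℕ.pred p))
    σ-last = cong (fold x σ) (sym (ℕ.suc-pred p))
  ...   | suc j = subst (_∈ orbit x) (sym (σ-injective σy≡)) (∈-orbit x (ℕ.<-trans (ℕ.n<1+n j) (subst (_< p) k≡ (Fin.toℕ<n k))))

  Closed : List (Fin m) → Set
  Closed xs = ∀ {y} → y ∈ xs → σ y ∈ xs

  p∣length : ∀ n xs → length xs ℕ.≤ n → Unique xs → Closed xs → p ∣ length xs
  p∣length n [] _ _ _ = p ∣0
  p∣length (suc n) (x ∷ xs) (s≤s xs≤n) xs! closed =
    subst (p ∣_) split (∣m∣n⇒∣m+n ∣-refl (p∣length n outside outside≤n (Unique.filter⁺ ∉O? xs!) outside-closed))
    where
    O : List (Fin m)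
    O = orbit x
    ∉O? : Decidable (_∉ O)
    ∉O? y = ¬? (y ∈? O)
    inside outside : List (Fin m)
    inside = filter (_∈? O) (x ∷ xs)
    outside = filter ∉O? (x ∷ xs)
    length-inside : length inside ≡ p
    length-inside = trans (ℕ.≤-antisym
      (unique⊆⇒length≤ (Unique.filter⁺ (_∈? O) xs!) (λ z∈ → proj₂ (∈-filter⁻ (_∈? O) {xs = x ∷ xs} z∈)))
      (unique⊆⇒length≤ (orbit-unique x) O⊆inside)) (length-orbit x)
      where
      O⊆inside : ∀ {z} → z ∈ O → z ∈ inside
      O⊆inside {z} z∈O with ∈-tabulate⁻ z∈O
      ... | k , refl = ∈-filter⁺ (_∈? O) (reach (toℕ k)) z∈O
        where
        reach : ∀ k → fold x σ k ∈ x ∷ xs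
        reach zero = here refl
        reach (suc k) = closed (reach k)
    split : p ℕ.+ length outside ≡ length (x ∷ xs)
    split = trans (cong (ℕ._+ length outside) (sym length-inside)) (length-filter-split (_∈? O) (x ∷ xs))
    outside≤n : length outside ℕ.≤ n
    outside≤n = ℕ.+-cancelˡ-≤ 1 _ _ (ℕ.≤-trans (ℕ.+-monoˡ-≤ (length outside) (ℕ.≤-trans (s≤s z≤n) (ℕ.≤-reflexive (ℕ.suc-pred p))))
                                                (ℕ.≤-trans (ℕ.≤-reflexive split) (s≤s xs≤n)))
    outside-closed : Closed outside
    outside-closed y∈ with ∈-filter⁻ ∉O? {xs = x ∷ xs} y∈
    ... | y∈xs , y∉O = ∈-filter⁺ ∉O? (closed y∈xs) (λ σy∈O → y∉O (σ⁻¹-orbit x σy∈O))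

  p∣m : p ∣ m
  p∣m = subst (p ∣_) (length-tabulate id) (p∣length m (allFin m) (ℕ.≤-reflexive (length-tabulate id)) (Unique.allFin⁺ m) (λ {y} _ → ∈-allFin (σ y)))

module IndexDivisibility (g : List ℚ) where

  open RationalPolynomial using (_≋_; ∷-cong; ≋-refl; ≋-sym; ≋-trans; ≡⇒≋; addP-identityʳ; ≈P⇒≋; ≋⇒≈P; constant)
  open QuotientRing g
  open CommutativeRing K using (refl; sym; trans)
  open Evaluation K constant constant-isRingHomomorphismᴷ using (eval; Integral)
  open IntegralClosure K constant constant-isRingHomomorphismᴷ using (integral-+)
  open IntegerRingSolver K constant constant-isRingHomomorphismᴷ
  open IsRingHomomorphism constant-isRingHomomorphismᴷ using (+-homo)
  open IntegerPolynomial using (monic; _+ₚ_; -ₚ_)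
  open IntegerToRational

  evalAt≡eval : ∀ P α → evalAt P α ≡ eval P α
  evalAt≡eval [] α = ≡.refl
  evalAt≡eval (c ∷ P) α = ≡.cong (λ t → addP (constant c) (mulP α t)) (evalAt≡eval P α)

  InZK⇒Integral : ∀ {α} → InZK g α → Integral α
  InZK⇒Integral {α} (_ , (cs , ≡.refl) , q , q*g≈P) = cs , multiple q
    (≋-trans (≈P⇒≋ q*g≈P) (≋-sym (≋-trans (addP-identityʳ _) (≡⇒≋ (≡.sym (evalAt≡eval (monic cs) α))))))

  Integral⇒InZK : ∀ {α} → Integral α → InZK g α
  Integral⇒InZK {α} (cs , multiple q q*g≋P) = monic cs , (cs , ≡.refl) , q ,
    ≋⇒≈P (≋-trans q*g≋P (≋-trans (addP-identityʳ _) (≡⇒≋ (≡.sym (evalAt≡eval (monic cs) α)))))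

  ℤ[θ] : List ℚ → Set
  ℤ[θ] α = ∃ λ h → α ~ toℚP h

  InZθ⇒ℤ[θ] : ∀ {α} → InZθ g α → ℤ[θ] α
  InZθ⇒ℤ[θ] (h , g∣α-h) = h , DividesP⇒~ g∣α-h

  ℤ[θ]⇒InZθ : ∀ {α} → ℤ[θ] α → InZθ g α
  ℤ[θ]⇒InZθ (h , α~h) = h , ~⇒DividesP α~h

  ℤ[θ]-resp : ∀ {α β} → α ~ β → ℤ[θ] α → ℤ[θ] β
  ℤ[θ]-resp α~β (h , α~h) = h , trans (sym α~β) α~h

  toℚP-+ₚ : ∀ h₁ h₂ → toℚP (h₁ +ₚ h₂) ≋ addP (toℚP h₁) (toℚP h₂)
  toℚP-+ₚ [] h₂ = ≋-refl
  toℚP-+ₚ (a ∷ h₁) [] = ≋-refl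
  toℚP-+ₚ (a ∷ h₁) (b ∷ h₂) = ∷-cong (/1-+ a b) (toℚP-+ₚ h₁ h₂)

  toℚP--ₚ : ∀ h → toℚP (-ₚ h) ≋ negP (toℚP h)
  toℚP--ₚ [] = ≋-refl
  toℚP--ₚ (a ∷ h) = ∷-cong (/1-neg a) (toℚP--ₚ h)

  ℤ[θ]-+ : ∀ {α β} → ℤ[θ] α → ℤ[θ] β → ℤ[θ] (addP α β)
  ℤ[θ]-+ (h₁ , α~h₁) (h₂ , β~h₂) = h₁ +ₚ h₂ , trans (~-+ α~h₁ β~h₂) (≋⇒~ (≋-sym (toℚP-+ₚ h₁ h₂)))

  ℤ[θ]-neg : ∀ {α} → ℤ[θ] α → ℤ[θ] (negP α)
  ℤ[θ]-neg (h , α~h) = -ₚ h , trans (~-neg α~h) (≋⇒~ (≋-sym (toℚP--ₚ h)))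

  module _ {η : List ℚ} (p : ℕ) .{{_ : ℕ.NonZero p}} (η-integral : Integral η)
    (pη∈ℤ[θ] : ℤ[θ] (mulP (constant (+ p)) η)) (kη∈ℤ[θ]⇒p∣k : ∀ k → ℤ[θ] (mulP (constant (+ k)) η) → p ∣ k)
    {m : ℕ} (index : IsIndex g m) where

    reps : Fin m → List ℚ
    reps = proj₁ index

    reps-integral : ∀ i → InZK g (reps i)
    reps-integral = proj₁ (proj₂ index)

    cover : ∀ α → InZK g α → ∃ λ i → InZθ g (subP α (reps i))
    cover = proj₁ (proj₂ (proj₂ index))

    irredundant : ∀ i j → InZθ g (subP (reps i) (reps j)) → i ≡ j
    irredundant = proj₂ (proj₂ (proj₂ index))

    class-of-shift : ∀ i → ∃ λ j → InZθ g (subP (addP (reps i) η) (reps j))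
    class-of-shift i = cover (addP (reps i) η) (Integral⇒InZK (integral-+ (InZK⇒Integral (reps-integral i)) η-integral))

    shift : Fin m → Fin m
    shift i = proj₁ (class-of-shift i)

    shift-spec : ∀ i → ℤ[θ] (subP (addP (reps i) η) (reps (shift i)))
    shift-spec i = InZθ⇒ℤ[θ] (proj₂ (class-of-shift i))

    fold-shift : ∀ k i → ℤ[θ] (subP (addP (reps i) (mulP (constant (+ k)) η)) (reps (fold i shift k)))
    fold-shift zero i = (+ 0 ∷ []) , solve 2 (λ r e → r :+ con (+ 0) :* e :- r := con (+ 0)) refl (reps i) η
    fold-shift (suc k) i = ℤ[θ]-resp telescope (ℤ[θ]-+ (fold-shift k i) (shift-spec j))
      where
      j : Fin m
      j = fold i shift k
      telescope : addP (subP (addP (reps i) (mulP (constant (+ k)) η)) (reps j)) (subP (addP (reps j) η) (reps (shift j)))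
                  ~ subP (addP (reps i) (mulP (constant (+ suc k)) η)) (reps (shift j))
      telescope = trans
        (solve 5 (λ a c b e d → (a :+ c :* e :- b) :+ (b :+ e :- d) := a :+ (con (+ 1) :+ c) :* e :- d) refl
          (reps i) (constant (+ k)) (reps j) η (reps (shift j)))
        (~-+ (~-+ (~-refl {reps i}) (~-* (sym (+-homo (+ 1) (+ k))) (~-refl {η}))) (~-refl {negP (reps (shift j))}))

    period : ∀ i → fold i shift p ≡ i
    period i = ≡.sym (irredundant i (fold i shift p) (ℤ[θ]⇒InZθ (ℤ[θ]-resp cancel (ℤ[θ]-+ (fold-shift p i) (ℤ[θ]-neg pη∈ℤ[θ])))))
      where
      cancel : addP (subP (addP (reps i) (mulP (constant (+ p)) η)) (reps (fold i shift p))) (negP (mulP (constant (+ p)) η))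
               ~ subP (reps i) (reps (fold i shift p))
      cancel = solve 3 (λ a c b → a :+ c :- b :+ :- c := a :- b) refl (reps i) (mulP (constant (+ p)) η) (reps (fold i shift p))

    free : ∀ i k → fold i shift k ≡ i → p ∣ k
    free i k returns = kη∈ℤ[θ]⇒p∣k k (ℤ[θ]-resp (solve 2 (λ a c → a :+ c :- a := c) refl (reps i) (mulP (constant (+ k)) η))
      (≡.subst (λ j → ℤ[θ] (subP (addP (reps i) (mulP (constant (+ k)) η)) (reps j))) returns (fold-shift k i)))

    p∣index : p ∣ m
    p∣index = CyclicAction.p∣m shift p period free

module MultiplesOfP (p : ℕ) where

  open import Data.Nat using (s≤s)
  open import Data.Rational as ℚ using (_/_) renaming (_+_ to _+ℚ_; _*_ to _*ℚ_; -_ to -ℚ_)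
  import Data.Rational.Properties as ℚ
  open import Data.Integer.Solver using (module +-*-Solver)
  open import Relation.Binary.PropositionalEquality
  open RationalPolynomial using (coeff; coeff-mulP; coeff-monic-top; coeff-monic-above)
  open IntegerToRational
  open IntegerPolynomial using (monic)
  open +-*-Solver using (solve; _:+_; _:*_; :-_; _:=_)

  pℤ : ℚ → Set
  pℤ r = ∃ λ z → r ≡ (+ p ℤ.* z) / 1

  pℤ-0 : pℤ 0ℚ
  pℤ-0 = + 0 , cong (_/ 1) (sym (ℤ.*-zeroʳ (+ p)))
    where import Data.Integer.Properties as ℤ

  pℤ-+ : ∀ {r s} → pℤ r → pℤ s → pℤ (r +ℚ s)
  pℤ-+ (z , refl) (w , refl) = z ℤ.+ w , trans (sym (/1-+ (+ p ℤ.* z) (+ p ℤ.* w)))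
    (cong (_/ 1) (solve 3 (λ p z w → p :* z :+ p :* w := p :* (z :+ w)) refl (+ p) z w))

  pℤ-neg : ∀ {r} → pℤ r → pℤ (-ℚ r)
  pℤ-neg (z , refl) = ℤ.- z , trans (sym (/1-neg (+ p ℤ.* z))) (cong (_/ 1) (solve 2 (λ p z → :- (p :* z) := p :* (:- z)) refl (+ p) z))

  pℤ-*ℤ : ∀ {r} w → pℤ r → pℤ (r *ℚ (w / 1))
  pℤ-*ℤ w (z , refl) = z ℤ.* w , trans (sym (/1-* (+ p ℤ.* z) w)) (cong (_/ 1) (solve 3 (λ p z w → p :* z :* w := p :* (z :* w)) refl (+ p) z w))

  pℤ-cancelʳ : ∀ {r s} → pℤ (r +ℚ s) → pℤ s → pℤ r
  pℤ-cancelʳ {r} {s} r+s∈ s∈ = subst pℤ (trans (ℚ.+-assoc r s (-ℚ s)) (trans (cong (r +ℚ_) (ℚ.+-inverseʳ s)) (ℚ.+-identityʳ r)))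
    (pℤ-+ r+s∈ (pℤ-neg s∈))

  pℤ⇒∣ : ∀ {k} → pℤ (+ k / 1) → p ∣ k
  pℤ⇒∣ {k} (z , k≡pz) = divides ℤ.∣ z ∣ (trans (cong ℤ.∣_∣ (/1-injective {+ k} {+ p ℤ.* z} k≡pz)) (trans (ℤ.abs-* (+ p) z) (ℕ.*-comm p ℤ.∣ z ∣)))
    where
    import Data.Integer.Properties as ℤ
    open import Data.Nat.Divisibility using (divides)

  coeff-toℚP : ∀ h n → ∃ λ z → coeff (toℚP h) n ≡ z / 1
  coeff-toℚP [] n = + 0 , refl
  coeff-toℚP (a ∷ h) zero = a , refl
  coeff-toℚP (a ∷ h) (suc n) = coeff-toℚP h n

  pℤ-*-integral : ∀ q h → (∀ n → pℤ (coeff q n)) → ∀ n → pℤ (coeff (mulP q (toℚP h)) n)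
  pℤ-*-integral [] h _ n = pℤ-0
  pℤ-*-integral (a ∷ q) h q∈ n = subst pℤ (sym (coeff-mulP a q (toℚP h) n)) (pℤ-+ head-term (tail-term n))
    where
    head-term : pℤ (a *ℚ coeff (toℚP h) n)
    head-term with coeff-toℚP h n
    ... | w , eq = subst pℤ (cong (a *ℚ_) (sym eq)) (pℤ-*ℤ w (q∈ zero))
    tail-term : ∀ n → pℤ (coeff (0ℚ ∷ mulP q (toℚP h)) n)
    tail-term zero = pℤ-0
    tail-term (suc n) = pℤ-*-integral q h (λ k → q∈ (suc k)) n

  pℤ-quotient-by-monic : ∀ cs q → (∀ n → length cs ℕ.≤ n → pℤ (coeff (mulP q (toℚP (monic cs))) n)) →
                         ∀ n → pℤ (coeff q n)
  pℤ-quotient-by-monic cs [] _ n = pℤ-0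
  pℤ-quotient-by-monic cs (a ∷ q) high = λ { zero → a∈ ; (suc n) → q∈ n }
    where
    g : List ℚ
    g = toℚP (monic cs)
    high′ : ∀ n → length cs ℕ.≤ n → pℤ (coeff (mulP q g) n)
    high′ n cs≤n = subst pℤ shifted (high (suc n) (ℕ.m≤n⇒m≤1+n cs≤n))
      where
      shifted : coeff (mulP (a ∷ q) g) (suc n) ≡ coeff (mulP q g) n
      shifted = trans (coeff-mulP a q g (suc n)) (trans (cong (λ t → a *ℚ t +ℚ coeff (mulP q g) n) (coeff-monic-above cs (s≤s cs≤n)))
                  (trans (cong (_+ℚ coeff (mulP q g) n) (ℚ.*-zeroʳ a)) (ℚ.+-identityˡ _)))
    q∈ : ∀ n → pℤ (coeff q n)
    q∈ = pℤ-quotient-by-monic cs q high′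
    lower : ∀ n → pℤ (coeff (0ℚ ∷ mulP q g) n)
    lower zero = pℤ-0
    lower (suc n) = pℤ-*-integral q (monic cs) q∈ n
    a∈ : pℤ a
    a∈ = subst pℤ (ℚ.*-identityʳ a) (pℤ-cancelʳ (subst pℤ top (high (length cs) ℕ.≤-refl)) (lower (length cs)))
      where
      top : coeff (mulP (a ∷ q) g) (length cs) ≡ a *ℚ 1ℚ +ℚ coeff (0ℚ ∷ mulP q g) (length cs)
      top = trans (coeff-mulP a q g (length cs)) (cong (λ t → a *ℚ t +ℚ coeff (0ℚ ∷ mulP q g) (length cs)) (coeff-monic-top cs))

module ElementOfOrderP (c₀ : ℤ) (R : List ℤ) (p : ℕ) .{{_ : ℕ.NonZero p}} (c : ℤ)
  (c₀≡ : c₀ ≡ + p ℤ.* (+ p ℤ.* c)) (c₀≢0 : c₀ ≢ + 0) where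

  open import Data.Rational as ℚ using (_/_)
  import Data.Rational.Properties as ℚ
  open import Data.List.Properties using (length-++; ++-assoc)
  open import Data.Integer.Solver using (module +-*-Solver)
  open IntegerPolynomial
  open IntegerToRational
  open RationalPolynomial using (_≋_; ∷-cong; ≋-refl; ≋-trans; ≋-sym; addP-cong; X; X-*; mulP-identityˡ; addP-identityʳ; constant;
                                 coeff; coeff-subP; coeff-constant-*; constant-inverse; mulP-assoc; mulP-congʳ; mulP-congˡ;
                                 coeff-monic-top; coeff-monic-above)

  G : List ℤ
  G = monic (+ 0 ∷ R)

  g : List ℚ
  g = toℚP (c₀ ∷ G)

  open QuotientRing g
  open IndexDivisibility g using (ℤ[θ])
  open CommutativeRing K hiding (zero)
  open Evaluation K constant constant-isRingHomomorphismᴷ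
  open IntegerRingSolver K constant constant-isRingHomomorphismᴷ
  open IsRingHomomorphism constant-isRingHomomorphismᴷ using (*-homo; -‿homo; ⟦⟧-cong)
  open import Relation.Binary.Reasoning.Setoid setoid
  open import Algebra.Properties.Semiring.Exp semiring using (_^_)

  θ : List ℚ
  θ = X

  eval-θ : ∀ h → eval h θ ≈ toℚP h
  eval-θ [] = refl
  eval-θ (a ∷ h) = trans (+-congˡ {constant a} (*-congˡ {θ} (eval-θ h)))
    (≋⇒~ (≋-trans (addP-cong (≋-refl {constant a}) (X-* (toℚP h))) (∷-cong (ℚ.+-identityʳ (a / 1)) ≋-refl)))

  g≈0 : g ≈ 0#
  g≈0 = multiple (1ℚ ∷ []) (≋-trans (mulP-identityˡ g) (≋-sym (addP-identityʳ g)))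

  θG : θ * toℚP G ≈ - constant c₀
  θG = begin
    θ * toℚP G                       ≈⟨ solve 2 (λ a b → b := a :+ b :- a) refl (constant c₀) (θ * toℚP G) ⟩
    constant c₀ + θ * toℚP G - constant c₀
      ≈⟨ +-congʳ { - constant c₀} (trans (+-congˡ {constant c₀} (*-congˡ {θ} (sym (eval-θ G)))) (trans (eval-θ (c₀ ∷ G)) g≈0)) ⟩
    0# - constant c₀                 ≈⟨ +-identityˡ (- constant c₀) ⟩
    - constant c₀                    ∎

  1/p : List ℚ
  1/p = proj₁ (constant-inverse (+ p) (λ p≡0 → ℕ.≢-nonZero⁻¹ p (≡.cong ℤ.∣_∣ p≡0)))

  1/p*p : mulP 1/p (constant (+ p)) ≋ 1ℚ ∷ []
  1/p*p = proj₂ (constant-inverse (+ p) (λ p≡0 → ℕ.≢-nonZero⁻¹ p (≡.cong ℤ.∣_∣ p≡0)))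

  η : List ℚ
  η = 1/p * toℚP G

  pη≈G : constant (+ p) * η ≈ toℚP G
  pη≈G = begin
    constant (+ p) * (1/p * toℚP G)  ≈⟨ solve 3 (λ q w x → q :* (w :* x) := (w :* q) :* x) refl (constant (+ p)) 1/p (toℚP G) ⟩
    1/p * constant (+ p) * toℚP G    ≈⟨ trans (*-congʳ {toℚP G} (≋⇒~ 1/p*p)) (*-identityˡ (toℚP G)) ⟩
    toℚP G                           ∎

  u : ℤ
  u = ℤ.- (+ p ℤ.* c)

  θη≈u : θ * η ≈ constant u
  θη≈u = begin
    θ * (1/p * toℚP G)                               ≈⟨ x∙yz≈y∙xz θ 1/p (toℚP G) ⟩
    1/p * (θ * toℚP G)                               ≈⟨ *-congˡ {1/p} (trans θG (-‿cong (trans (⟦⟧-cong c₀≡) (*-homo (+ p) (+ p ℤ.* c))))) ⟩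
    1/p * - (constant (+ p) * constant (+ p ℤ.* c))
      ≈⟨ solve 3 (λ w q x → w :* (:- (q :* x)) := :- ((w :* q) :* x)) refl 1/p (constant (+ p)) (constant (+ p ℤ.* c)) ⟩
    - (1/p * constant (+ p) * constant (+ p ℤ.* c))
      ≈⟨ -‿cong (trans (*-congʳ {constant (+ p ℤ.* c)} (≋⇒~ 1/p*p)) (*-identityˡ (constant (+ p ℤ.* c)))) ⟩
    - constant (+ p ℤ.* c)                           ≈⟨ -‿homo (+ p ℤ.* c) ⟨
    constant u                                       ∎
    where open import Algebra.Properties.CommutativeSemigroup *-commutativeSemigroup using (x∙yz≈y∙xz)

  u²≡c₀c : u ℤ.* u ≡ c₀ ℤ.* c
  u²≡c₀c = ≡.trans (ℤ-solve 2 (λ q d → (ℤ-:- (q ℤ-:* d)) ℤ-:* (ℤ-:- (q ℤ-:* d)) ℤ-:= (q ℤ-:* (q ℤ-:* d)) ℤ-:* d) ≡.refl (+ p) c)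
                   (≡.cong (ℤ._* c) (≡.sym c₀≡))
    where open +-*-Solver renaming (solve to ℤ-solve; _:*_ to _ℤ-:*_; :-_ to ℤ-:-_; _:=_ to _ℤ-:=_)

  -- By θη = u, ηⁿ·g(θ) is the reversal of g evaluated at η.  As g has no linear term, every
  -- coefficient of the reversal except the leading c₀ is a multiple of u² = c₀c.
  module Integrality (b : ℤ) (rest : List ℤ) (monic-R≡ : monic R ≡ b ∷ rest) where
    Xᵣ : List ℤ
    Xᵣ = reversal u b rest
    E : List ℤ
    E = c ·ₚ Xᵣ ++ (+ 0 ∷ [])

    eval-E : eval (monic E) η ≈ constant c * eval Xᵣ η + η ^ length Xᵣ * η
    eval-E = begin
      eval (monic E) η                                          ≡⟨ ≡.cong (λ l → eval l η) (++-assoc (c ·ₚ Xᵣ) (+ 0 ∷ []) (+ 1 ∷ [])) ⟩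
      eval (c ·ₚ Xᵣ ++ (+ 0 ∷ + 1 ∷ [])) η                        ≈⟨ eval-·ₚ-++ c Xᵣ (+ 0 ∷ + 1 ∷ []) η ⟩
      constant c * eval Xᵣ η + η ^ length Xᵣ * eval (+ 0 ∷ + 1 ∷ []) η
        ≈⟨ +-congˡ {constant c * eval Xᵣ η} (*-congˡ {η ^ length Xᵣ} (+-congˡ {constant (+ 0)} (*-congˡ {η} (eval-singleton (+ 1) η)))) ⟩
      constant c * eval Xᵣ η + η ^ length Xᵣ * (constant (+ 0) + η * constant (+ 1))
        ≈⟨ +-congˡ {constant c * eval Xᵣ η} (*-congˡ {η ^ length Xᵣ} (solve 1 (λ e → con (+ 0) :+ e :* con (+ 1) := e) refl η)) ⟩
      constant c * eval Xᵣ η + η ^ length Xᵣ * η                   ∎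

    eval-reversal-g : eval (reversal u c₀ (+ 0 ∷ b ∷ rest)) η ≈ constant c₀ * eval (monic E) η
    eval-reversal-g = begin
      eval (u ·ₚ (u ·ₚ Xᵣ ++ (+ 0 ∷ [])) ++ (c₀ ∷ [])) η
        ≈⟨ eval-·ₚ-++ u (u ·ₚ Xᵣ ++ (+ 0 ∷ [])) (c₀ ∷ []) η ⟩
      constant u * eval (u ·ₚ Xᵣ ++ (+ 0 ∷ [])) η + η ^ length (u ·ₚ Xᵣ ++ (+ 0 ∷ [])) * eval (c₀ ∷ []) η
        ≈⟨ +-cong (*-congˡ {constant u} (eval-·ₚ-++ u Xᵣ (+ 0 ∷ []) η))
                  (*-cong (reflexive (≡.cong (η ^_) length-u·Xᵣ∷0)) (eval-singleton c₀ η)) ⟩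
      constant u * (constant u * eval Xᵣ η + η ^ length Xᵣ * eval (+ 0 ∷ []) η) + η * η ^ length Xᵣ * constant c₀
        ≈⟨ +-congʳ {η * η ^ length Xᵣ * constant c₀}
             (*-congˡ {constant u} (+-congˡ {constant u * eval Xᵣ η} (*-congˡ {η ^ length Xᵣ} (eval-singleton (+ 0) η)))) ⟩
      constant u * (constant u * eval Xᵣ η + η ^ length Xᵣ * constant (+ 0)) + η * η ^ length Xᵣ * constant c₀
        ≈⟨ solve 5 (λ U V P e C → U :* (U :* V :+ P :* con (+ 0)) :+ e :* P :* C := (U :* U) :* V :+ e :* P :* C)
             refl (constant u) (eval Xᵣ η) (η ^ length Xᵣ) η (constant c₀) ⟩
      constant u * constant u * eval Xᵣ η + η * η ^ length Xᵣ * constant c₀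
        ≈⟨ +-congʳ {η * η ^ length Xᵣ * constant c₀}
             (*-congʳ {eval Xᵣ η} (trans (sym (*-homo u u)) (trans (⟦⟧-cong u²≡c₀c) (*-homo c₀ c)))) ⟩
      constant c₀ * constant c * eval Xᵣ η + η * η ^ length Xᵣ * constant c₀
        ≈⟨ solve 5 (λ C c V P e → C :* c :* V :+ e :* P :* C := C :* (c :* V :+ P :* e))
          refl (constant c₀) (constant c) (eval Xᵣ η) (η ^ length Xᵣ) η ⟩
      constant c₀ * (constant c * eval Xᵣ η + η ^ length Xᵣ * η)
        ≈⟨ *-congˡ {constant c₀} eval-E ⟨
      constant c₀ * eval (monic E) η ∎
      where
      length-u·Xᵣ∷0 : length (u ·ₚ Xᵣ ++ (+ 0 ∷ [])) ≡ suc (length Xᵣ)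
      length-u·Xᵣ∷0 = ≡.trans (length-++ (u ·ₚ Xᵣ)) (≡.trans (ℕ.+-comm _ 1) (≡.cong suc (length-·ₚ u Xᵣ)))

    c₀E≈0 : constant c₀ * eval (monic E) η ≈ 0#
    c₀E≈0 = begin
      constant c₀ * eval (monic E) η                                  ≈⟨ eval-reversal-g ⟨
      eval (reversal u c₀ (+ 0 ∷ b ∷ rest)) η                          ≈⟨ eval-reversal θη≈u c₀ (+ 0 ∷ b ∷ rest) ⟨
      η ^ length (+ 0 ∷ b ∷ rest) * eval (c₀ ∷ + 0 ∷ b ∷ rest) θ
        ≈⟨ *-congˡ {η ^ length (+ 0 ∷ b ∷ rest)} (trans (eval-θ (c₀ ∷ + 0 ∷ b ∷ rest)) g′≈0) ⟩
      η ^ length (+ 0 ∷ b ∷ rest) * 0#                                 ≈⟨ zeroʳ (η ^ length (+ 0 ∷ b ∷ rest)) ⟩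
      0#                                                               ∎
      where
      g′≈0 : toℚP (c₀ ∷ + 0 ∷ b ∷ rest) ≈ 0#
      g′≈0 = ≡.subst (λ l → toℚP (c₀ ∷ + 0 ∷ l) ≈ 0#) monic-R≡ g≈0

    integral : Integral η
    integral = E , constant-cancel c₀≢0 c₀E≈0

  η-integral : Integral η
  η-integral = let b , rest , monic-R≡ , _ = monic-uncons R in Integrality.integral b rest monic-R≡

  -- With Q = p·q, Q·g = k·G − p·h.  Above deg G only p·h contributes, so Q ∈ pℤ[x] as g is monic;
  -- then the coefficient k − p·h_(deg G) of Q·g lies in pℤ.
  kη∈ℤ[θ]⇒p∣k : ∀ k → ℤ[θ] (constant (+ k) * η) → p ∣ k
  kη∈ℤ[θ]⇒p∣k k (h , multiple q q*g≋kη-h) = pℤ⇒∣ (≡.subst pℤ (ℚ.*-identityʳ (+ k / 1)) (pℤ-cancelʳ k-ph∈ (pℤ-neg (ph∈ N))))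
    where
    open MultiplesOfP p
    Q : List ℚ
    Q = mulP (constant (+ p)) q
    Q*g≋ : mulP Q g ≋ subP (mulP (constant (+ k)) (toℚP G)) (mulP (constant (+ p)) (toℚP h))
    Q*g≋ = ≋-trans (mulP-assoc (constant (+ p)) q g) (≋-trans (mulP-congʳ (constant (+ p)) q*g≋kη-h) (≋-trans
      (solveₚ 5 (λ P K W G H → P :*ₚ (K :*ₚ (W :*ₚ G) :-ₚ H) :=ₚ K :*ₚ ((W :*ₚ P) :*ₚ G) :-ₚ P :*ₚ H) ≋-refl
        (constant (+ p)) (constant (+ k)) 1/p (toℚP G) (toℚP h))
      (addP-cong (mulP-congʳ (constant (+ k)) (≋-trans (mulP-congˡ (toℚP G) 1/p*p) (mulP-identityˡ (toℚP G)))) ≋-refl)))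
      where
      open IntegerRingSolver RationalPolynomial.ℚ[x] constant RationalPolynomial.constant-isRingHomomorphism
        using () renaming (solve to solveₚ; _:=_ to _:=ₚ_; _:*_ to _:*ₚ_; _:-_ to _:-ₚ_)
    ph∈ : ∀ n → pℤ ((+ p / 1) ℚ.* coeff (toℚP h) n)
    ph∈ n = let w , h≡w = coeff-toℚP h n in w , ≡.trans (≡.cong ((+ p / 1) ℚ.*_) h≡w) (≡.sym (/1-* (+ p) w))
    kG-ph : ℕ → ℚ → ℚ
    kG-ph n G-coeff = (+ k / 1) ℚ.* G-coeff ℚ.+ ℚ.- ((+ p / 1) ℚ.* coeff (toℚP h) n)
    coeff-Q*g : ∀ n → coeff (mulP Q g) n ≡ kG-ph n (coeff (toℚP G) n)
    coeff-Q*g n = ≡.trans (_≋_.at Q*g≋ n) (≡.trans (coeff-subP (mulP (constant (+ k)) (toℚP G)) (mulP (constant (+ p)) (toℚP h)) n)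
      (≡.cong₂ (λ a b → a ℚ.+ ℚ.- b) (coeff-constant-* (+ k) (toℚP G) n) (coeff-constant-* (+ p) (toℚP h) n)))
    high : ∀ n → length (c₀ ∷ + 0 ∷ R) ℕ.≤ n → pℤ (coeff (mulP Q g) n)
    high n deg≤n = ≡.subst pℤ (≡.sym (≡.trans (coeff-Q*g n) (≡.cong (kG-ph n) (coeff-monic-above (+ 0 ∷ R) deg≤n))))
      (pℤ-+ (≡.subst pℤ (≡.sym (ℚ.*-zeroʳ (+ k / 1))) pℤ-0) (pℤ-neg (ph∈ n)))
    N : ℕ
    N = length (+ 0 ∷ R)
    k-ph∈ : pℤ (kG-ph N 1ℚ)
    k-ph∈ = ≡.subst pℤ (≡.trans (coeff-Q*g N) (≡.cong (kG-ph N) (coeff-monic-top (+ 0 ∷ R))))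
      (pℤ-*-integral Q (c₀ ∷ G) (pℤ-quotient-by-monic (c₀ ∷ + 0 ∷ R) Q high) N)

  p∣index : ∀ {m} → IsIndex g m → p ∣ m
  p∣index = IndexDivisibility.p∣index g p η-integral (G , pη≈G) kη∈ℤ[θ]⇒p∣k

module Expansion where

  open import Data.Nat using (_∸_)
  open import Data.List using (replicate)
  open import Data.List.Properties using (++-assoc; ++-identityʳ)
  open import Data.Sum using (_⊎_; inj₁; inj₂)
  open import Data.Empty using (⊥)
  open import Relation.Binary.PropositionalEquality
  open IntegerPolynomial using (monic; monic-uncons)
  open RationalPolynomial using (_≋_; ≈P⇒≋; ≋⇒≈P; X; X-*; coeff; coeff-monic-top)
  open _≋_

  expand-cons : ∀ ℓ c cs → expand ℓ (c ∷ monic cs) ≡ c ∷ (replicate (ℓ ∸ 1) (+ 0) ++ expand ℓ (monic cs))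
  expand-cons ℓ c cs = let d , ds , monic-cs≡ , _ = monic-uncons cs in
    trans (cong (λ l → expand ℓ (c ∷ l)) monic-cs≡) (cong (λ l → c ∷ (replicate (ℓ ∸ 1) (+ 0) ++ expand ℓ l)) (sym monic-cs≡))

  expand-monic : ∀ ℓ c cs → ∃ λ es → expand ℓ (monic (c ∷ cs)) ≡ monic (c ∷ (replicate (ℓ ∸ 1) (+ 0) ++ es))
  expand-monic ℓ c [] = [] , cong (λ l → c ∷ (l ++ (+ 1 ∷ []))) (sym (++-identityʳ (replicate (ℓ ∸ 1) (+ 0))))
  expand-monic ℓ c (d ∷ ds) = let es , expand≡ = expand-monic ℓ d ds in
    d ∷ (replicate (ℓ ∸ 1) (+ 0) ++ es) ,
    trans (expand-cons ℓ c (d ∷ ds)) (trans (cong (λ l → c ∷ (replicate (ℓ ∸ 1) (+ 0) ++ l)) expand≡)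
      (cong (c ∷_) (sym (++-assoc (replicate (ℓ ∸ 1) (+ 0)) (d ∷ (replicate (ℓ ∸ 1) (+ 0) ++ es)) (+ 1 ∷ [])))))

  expand-without-linear-term : ∀ k c cs → ∃ λ R → expand (suc (suc k)) (monic (c ∷ cs)) ≡ monic (c ∷ + 0 ∷ R)
  expand-without-linear-term k c cs = let es , expand≡ = expand-monic (suc (suc k)) c cs in replicate k (+ 0) ++ es , expand≡

  irreducible⇒constant≢0 : ∀ c r R → IrreducibleQ (toℚP (monic (c ∷ r ∷ R))) → c ≢ + 0
  irreducible⇒constant≢0 c r R (_ , factors-trivially) refl = not-constant (factors-trivially X f (≋⇒≈P (X-* f)))
    where
    f : List ℚ
    f = toℚP (monic (r ∷ R))
    1≢0 : 1ℚ ≢ 0ℚ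
    1≢0 ()
    not-constant : IsConstP X ⊎ IsConstP f → ⊥
    not-constant (inj₁ (a , X≈a)) = 1≢0 (at (≈P⇒≋ {X} {a ∷ []} X≈a) 1)
    not-constant (inj₂ (a , f≈a)) = 1≢0 (trans (sym (coeff-monic-top (r ∷ R))) (at (≈P⇒≋ {f} {a ∷ []} f≈a) (length (r ∷ R))))

module SquareDivisors where

  open import Data.Integer.Divisibility as ℤD using ()
  open import Data.Integer.Divisibility.Signed using (∣ᵤ⇒∣; module _∣_) renaming (_∣_ to _∣ₛ_)
  open import Data.Integer.Properties using (abs-*)
  open import Data.Nat.Divisibility using (∣1⇒≡1)
  open import Data.Integer.Solver using (module +-*-Solver)
  open import Relation.Nullary using (¬_)
  open +-*-Solver using (solve; _:*_; _:=_)

  square∤1 : ∀ p .{{_ : ℕ.NonTrivial p}} → ¬ (+ p ℤ.* + p) ℤD.∣ + 1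
  square∤1 p p²∣1 = ℕ.nonTrivial⇒≢1 (ℕ.m*n≡1⇒n≡1 p p (∣1⇒≡1 (≡.subst (_∣ 1) (abs-* (+ p) (+ p)) p²∣1)))

  square-quotient : ∀ p {z} → (+ p ℤ.* + p) ℤD.∣ z → ∃ λ c → z ≡ + p ℤ.* (+ p ℤ.* c)
  square-quotient p {z} p²∣z = c , ≡.trans (_∣_.equality p²∣ₛz) (solve 2 (λ q x → x :* (q :* q) := q :* (q :* x)) ≡.refl (+ p) c)
    where
    p²∣ₛz : (+ p ℤ.* + p) ∣ₛ z
    p²∣ₛz = ∣ᵤ⇒∣ {+ p ℤ.* + p} {z} p²∣z
    c : ℤ
    c = _∣_.quotient p²∣ₛz

open import Data.Nat using (ℕ; _<_)
open import Data.Nat.Primality using (Prime)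
open import Data.Integer using (+_; _*_)
open import Data.Integer.Divisibility as ℤD using ()
open import Data.Nat.Divisibility using (_∣_)
open import Data.List using (List)
open import Data.Nat.Primality using (prime)
open import Data.Nat using (s≤s)
open import Relation.Nullary using (contradiction)
open IntegerPolynomial using (monic)

-- Primality of p is only used as p > 1, and irreducibility only as f(0) ≠ 0.
proposition2p3 : (f : List Data.Integer.ℤ) (p : ℕ) → Monic f → Prime p →
    (+ p * + p) ℤD.∣ coeff0 f →
    (ℓ : ℕ) → 1 < ℓ → IrreducibleQ (toℚP (expand ℓ f)) →
    (m : ℕ) → IsIndex (toℚP (expand ℓ f)) m → p ∣ m
proposition2p3 .(monic []) p ([] , ≡.refl) (prime _) p²∣1 _ _ _ _ _ = contradiction p²∣1 (SquareDivisors.square∤1 p)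
proposition2p3 .(monic (c₀ ∷ cs)) p (c₀ ∷ cs , ≡.refl) (prime _) p²∣c₀ .(suc (suc k)) (s≤s (s≤s {n = k} _)) irreducible m index =
  ElementOfOrderP.p∣index c₀ R p c c₀≡ c₀≢0 (≡.subst (λ f → IsIndex (toℚP f) m) expand≡ index)
  where
  instance
    p≢0 : ℕ.NonZero p
    p≢0 = ℕ.nonTrivial⇒nonZero p
  R : List ℤ
  R = proj₁ (Expansion.expand-without-linear-term k c₀ cs)
  expand≡ : expand (suc (suc k)) (monic (c₀ ∷ cs)) ≡ monic (c₀ ∷ + 0 ∷ R)
  expand≡ = proj₂ (Expansion.expand-without-linear-term k c₀ cs)
  c₀≢0 : c₀ ≢ + 0
  c₀≢0 = Expansion.irreducible⇒constant≢0 c₀ (+ 0) R (≡.subst (λ f → IrreducibleQ (toℚP f)) expand≡ irreducible)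
  c : ℤ
  c = proj₁ (SquareDivisors.square-quotient p {c₀} p²∣c₀)
  c₀≡ : c₀ ≡ + p ℤ.* (+ p ℤ.* c)
  c₀≡ = proj₂ (SquareDivisors.square-quotient p {c₀} p²∣c₀)
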